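{- Let $\beta$ be odd and let $\mathcal C=\langle (b\mid 0),(0\mid fh+2f)\rangle$ be a separable $\mathbb{Z}_2\mathbb{Z}_4$-additive cyclic code of type $(\alpha,\beta;\gamma,\delta;\kappa)$, where $f,g,h\in\mathbb{Z}_4[x]$ are monic pairwise coprime with $fgh=x^\beta-1$ and $b\in\mathbb{Z}_2[x]$ divides $x^\alpha-1$. Then $$\mathcal C^\perp=\left\langle\left(\tfrac{x^\alpha-1}{b^*}\,\Big|\, 0\right),(0\mid g^*h^*+2g^*)\right\rangle.$$
   Context: A $\mathbb{Z}_2\mathbb{Z}_4$-additive code is a subgroup $\mathcal C$ of $\mathbb{Z}_2^\alpha\times\mathbb{Z}_4^\beta$; cyclic means invariant under simultaneously cyclically shifting binary and quaternary coordinates; vectors are identified with elements of $R_{\alpha,\beta}=\mathbb{Z}_2[x]/(x^\alpha-1)\times\mathbb{Z}_4[x]/(x^\beta-1)$, a $\mathbb{Z}_4[x]$-module via $\lambda\star(p\mid q)=(\lambda p\bmod2\mid\lambda q)$, and $\langle\cdot\rangle$ is the generated submodule. $\mathcal C$ is separable if $\mathcal C=\mathcal C_X\times\mathcal C_Y$ where $\mathcal C_X,\mathcal C_Y$ are the projections onto the binary and quaternary coordinates. Type: $\mathcal C\cong\mathbb{Z}_2^\gamma\times\mathbb{Z}_4^\delta$, $\kappa$ the dimension of the binary projection of the order-$\le2$ subcode. The dual is taken with respect to $\mathbf u\cdot\mathbf v=2\sum_iu_iv_i+\sum_ju'_jv'_j\in\mathbb{Z}_4$. $p^*(x)=x^{\deg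 p}p(x^{ -1})$ is the reciprocal polynomial. -}

module Defs where

open import Data.Nat using (ℕ; zero; suc; _+_; _*_; _<_)
open import Data.Fin using (Fin; fromℕ; inject₁) renaming (zero to fzero; suc to fsuc)
open import Data.List using (List; []; _∷_; map; reverse; replicate; _++_)
open import Data.Bool using (Bool; true; false)
open import Data.Product using (Σ; ∃; ∃-syntax; _×_; _,_; proj₁; proj₂)
open import Relation.Binary.PropositionalEquality using (_≡_)

data ℤ₂ : Set where
  0₂ 1₂ : ℤ₂

data ℤ₄ : Set where
  0₄ 1₄ 2₄ 3₄ : ℤ₄

toℕ₂ : ℤ₂ → ℕ
toℕ₂ 0₂ = 0
toℕ₂ 1₂ = 1

fromℕ₂ : ℕ → ℤ₂
fromℕ₂ zero = 0₂
fromℕ₂ (suc zero) = 1₂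
fromℕ₂ (suc (suc n)) = fromℕ₂ n

toℕ₄ : ℤ₄ → ℕ
toℕ₄ 0₄ = 0
toℕ₄ 1₄ = 1
toℕ₄ 2₄ = 2
toℕ₄ 3₄ = 3

fromℕ₄ : ℕ → ℤ₄
fromℕ₄ zero = 0₄
fromℕ₄ (suc zero) = 1₄
fromℕ₄ (suc (suc zero)) = 2₄
fromℕ₄ (suc (suc (suc zero))) = 3₄
fromℕ₄ (suc (suc (suc (suc n)))) = fromℕ₄ n

_+₂_ _*₂_ : ℤ₂ → ℤ₂ → ℤ₂
a +₂ b = fromℕ₂ (toℕ₂ a + toℕ₂ b)
a *₂ b = fromℕ₂ (toℕ₂ a * toℕ₂ b)

_+₄_ _*₄_ : ℤ₄ → ℤ₄ → ℤ₄
a +₄ b = fromℕ₄ (toℕ₄ a + toℕ₄ b)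
a *₄ b = fromℕ₄ (toℕ₄ a * toℕ₄ b)

isZero₂ : ℤ₂ → Bool
isZero₂ 0₂ = true
isZero₂ 1₂ = false

isZero₄ : ℤ₄ → Bool
isZero₄ 0₄ = true
isZero₄ _ = false

red : ℤ₄ → ℤ₂
red a = fromℕ₂ (toℕ₄ a)

twice : ℤ₂ → ℤ₄
twice 0₂ = 0₄
twice 1₂ = 2₄

-- Polynomials (coefficient lists, lowest degree first) over a ring A,
-- and the cyclic modules A[x]/(xⁿ - 1) represented as vectors Fin n → A.

module PolyOps {A : Set} (0# 1# : A) (_⊕_ _⊗_ : A → A → A) (isZero : A → Bool) where

  Poly : Set
  Poly = List A

  infixl 6 _+P_
  infixl 7 _*P_

  _+P_ : Poly → Poly → Poly
  [] +P q = q
  (a ∷ p) +P [] = a ∷ p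
  (a ∷ p) +P (b ∷ q) = (a ⊕ b) ∷ (p +P q)

  scaleP : A → Poly → Poly
  scaleP a = map (a ⊗_)

  _*P_ : Poly → Poly → Poly
  [] *P q = []
  (a ∷ p) *P q = scaleP a q +P (0# ∷ (p *P q))

  coeff : Poly → ℕ → A
  coeff [] _ = 0#
  coeff (a ∷ p) zero = a
  coeff (a ∷ p) (suc i) = coeff p i

  -- equality of polynomials (insensitive to trailing zeros)
  infix 4 _≈P_
  _≈P_ : Poly → Poly → Set
  p ≈P q = ∀ i → coeff p i ≡ coeff q i

  Monic : Poly → Set
  Monic p = ∃[ d ] (coeff p d ≡ 1# × (∀ i → d < i → coeff p i ≡ 0#))

  infix 4 _∣P_
  _∣P_ : Poly → Poly → Set
  p ∣P q = ∃[ r ] (p *P r ≈P q)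

  Coprime : Poly → Poly → Set
  Coprime p q = ∃[ u ] ∃[ v ] (u *P p +P v *P q ≈P (1# ∷ []))

  X^ : ℕ → Poly
  X^ n = replicate n 0# ++ (1# ∷ [])

  private
    dropZeros : Poly → Poly
    dropZeros [] = []
    dropZeros (a ∷ p) with isZero a
    ... | true = dropZeros p
    ... | false = a ∷ p

  -- reciprocal polynomial p*(x) = x^{deg p} p(1/x)
  recip : Poly → Poly
  recip p = dropZeros (reverse p)

  -- vectors of length n = elements of A[x]/(xⁿ - 1)
  Vec : ℕ → Set
  Vec n = Fin n → A

  zeroV : ∀ {n} → Vec n
  zeroV _ = 0#

  _+V_ : ∀ {n} → Vec n → Vec n → Vec n
  (u +V v) i = u i ⊕ v i

  scaleV : ∀ {n} → A → Vec n → Vec n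
  scaleV a v i = a ⊗ v i

  -- multiplication by x : cyclic shift (x·v)ᵢ = v_{i-1}
  shift : ∀ {n} → Vec n → Vec n
  shift {zero} v = v
  shift {suc n} v fzero = v (fromℕ n)
  shift {suc n} v (fsuc i) = v (inject₁ i)

  act : ∀ {n} → Poly → Vec n → Vec n
  act [] v = zeroV
  act (a ∷ p) v = scaleV a v +V shift (act p v)

  e₀ : ∀ {n} → Vec n
  e₀ {zero} ()
  e₀ {suc n} fzero = 1#
  e₀ {suc n} (fsuc i) = 0#

  embed : ∀ {n} → Poly → Vec n
  embed p = act p e₀

  sumV : ∀ {n} → Vec n → A
  sumV {zero} v = 0#
  sumV {suc n} v = v fzero ⊕ sumV (λ i → v (fsuc i))

module P₂ = PolyOps 0₂ 1₂ _+₂_ _*₂_ isZero₂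
module P₄ = PolyOps 0₄ 1₄ _+₄_ _*₄_ isZero₄

Poly₂ Poly₄ : Set
Poly₂ = P₂.Poly
Poly₄ = P₄.Poly

Xn-1₂ : ℕ → Poly₂
Xn-1₂ n = P₂.X^ n P₂.+P (1₂ ∷ [])

Xn-1₄ : ℕ → Poly₄
Xn-1₄ n = P₄.X^ n P₄.+P (3₄ ∷ [])

-- R_{α,β} = ℤ₂[x]/(x^α - 1) × ℤ₄[x]/(x^β - 1) as a ℤ₄[x]-module

Elem : ℕ → ℕ → Set
Elem α β = P₂.Vec α × P₄.Vec β

module _ {α β : ℕ} where

  0E : Elem α β
  0E = P₂.zeroV , P₄.zeroV

  _+E_ : Elem α β → Elem α β → Elem α β
  (u , u′) +E (v , v′) = (u P₂.+V v) , (u′ P₄.+V v′)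

  _⋆_ : Poly₄ → Elem α β → Elem α β
  l ⋆ (u , u′) = P₂.act (map red l) u , P₄.act l u′

  infix 4 _≋_
  _≋_ : Elem α β → Elem α β → Set
  (u , u′) ≋ (v , v′) = (∀ i → u i ≡ v i) × (∀ j → u′ j ≡ v′ j)

  ⟨_⟩ : List (Elem α β) → Elem α β → Set
  ⟨ [] ⟩ v = v ≋ 0E
  ⟨ g ∷ gs ⟩ v = ∃[ l ] ∃[ w ] (⟨ gs ⟩ w × v ≋ (l ⋆ g) +E w)

  _·_ : Elem α β → Elem α β → ℤ₄
  (u , u′) · (v , v′) =
    twice (P₂.sumV (λ i → u i *₂ v i)) +₄ P₄.sumV (λ j → u′ j *₄ v′ j)

  _⊥ : (Elem α β → Set) → Elem α β → Set
  (C ⊥) v = ∀ u → C u → u · v ≡ 0₄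

  bin : Poly₂ → Elem α β
  bin p = P₂.embed p , P₄.zeroV

  quat : Poly₄ → Elem α β
  quat q = P₂.zeroV , P₄.embed q

Odd : ℕ → Set
Odd n = ∃[ k ] (n ≡ suc (2 * k))

module Submission where

open import Defs
open import Data.Nat using (ℕ)
open import Data.List using (List; []; _∷_)
open import Data.Product using (_×_)

open import Data.Nat using (NonZero; _%_)
open import Data.Bool using (Bool; true)
open import Algebra.Structures using (IsCommutativeSemiring)
open import Relation.Binary.PropositionalEquality using (_≡_; refl)
open import Data.Product using (_,_; proj₁; proj₂)

-- Elements of R_{α,β} are pairs of vectors; a polynomial p acts on them
-- through the cyclic shift x, and p(x) is adjoint to p(x⁻¹) for the inner
-- product.  Hence, for any generators p, r, the code ⟨(p ∣ 0), (0 ∣ r)⟩ is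
-- the product p·ℤ₂[x]/(xᵅ-1) × r·ℤ₄[x]/(xᵝ-1), and its dual is
-- ann(p(x⁻¹)) × ann(r(x⁻¹)) (module Codes).  The theorem thus splits into:
--   * binary part: ann(b(x⁻¹)) = q·ℤ₂[x]/(xᵅ-1) when b* q = xᵅ - 1, since
--     b(x⁻¹) = xᵏ b* and ℤ₂[x] is an integral domain (module BinaryPart);
--   * quaternary part: ann(F(x⁻¹)) = G·ℤ₄[x]/(xᵝ-1) for F = fh + 2f and
--     G = g*h* + 2g*: "⊇" because F* G ∈ (f*g*h*, 4) = 0, and "⊆" by a
--     Bézout computation in the commutative ring of operators p(x⁻¹)
--     (modules QuaternaryAnnihilator and QuaternaryPart).  Oddness of β is only used through β ≥ 1.

module ResidueRing (N : ℕ) .{{_ : NonZero N}} {Z : Set} (toℕ : Z → ℕ) (fromℕ : ℕ → Z)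
  (fromℕ-toℕ : ∀ a → fromℕ (toℕ a) ≡ a)
  (toℕ-fromℕ : ∀ n → toℕ (fromℕ n) ≡ n % N)
  (fromℕ-% : ∀ n → fromℕ (n % N) ≡ fromℕ n) where

  open import Data.Nat using (_+_; _*_)
  open import Data.Product using (_,_)
  open import Data.Nat.Properties using (+-comm; +-assoc; *-comm; *-assoc; *-distribʳ-+; +-identityʳ)
  open import Data.Nat.DivMod using (%-distribˡ-+; %-distribˡ-*; m%n%n≡m%n)
  open import Algebra.Structures using (IsCommutativeSemiring)
  open import Algebra.Structures.Biased using (isCommutativeSemiringˡ)
  open import Relation.Binary.PropositionalEquality
  open ≡-Reasoning

  _⊕_ _⊗_ : Z → Z → Z
  a ⊕ b = fromℕ (toℕ a + toℕ b)
  a ⊗ b = fromℕ (toℕ a * toℕ b)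

  fromℕ-cong% : ∀ {m n} → m % N ≡ n % N → fromℕ m ≡ fromℕ n
  fromℕ-cong% {m} {n} e = trans (sym (fromℕ-% m)) (trans (cong fromℕ e) (fromℕ-% n))

  absorb-+ : ∀ m n → fromℕ (toℕ (fromℕ m) + n) ≡ fromℕ (m + n)
  absorb-+ m n = fromℕ-cong% (begin
    (toℕ (fromℕ m) + n) % N     ≡⟨ cong (λ x → (x + n) % N) (toℕ-fromℕ m) ⟩
    (m % N + n) % N             ≡⟨ %-distribˡ-+ (m % N) n N ⟩
    (m % N % N + n % N) % N     ≡⟨ cong (λ x → (x + n % N) % N) (m%n%n≡m%n m N) ⟩
    (m % N + n % N) % N         ≡⟨ %-distribˡ-+ m n N ⟨
    (m + n) % N                 ∎)

  absorb-* : ∀ m n → fromℕ (toℕ (fromℕ m) * n) ≡ fromℕ (m * n)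
  absorb-* m n = fromℕ-cong% (begin
    (toℕ (fromℕ m) * n) % N     ≡⟨ cong (λ x → (x * n) % N) (toℕ-fromℕ m) ⟩
    (m % N * n) % N             ≡⟨ %-distribˡ-* (m % N) n N ⟩
    (m % N % N * (n % N)) % N   ≡⟨ cong (λ x → (x * (n % N)) % N) (m%n%n≡m%n m N) ⟩
    (m % N * (n % N)) % N       ≡⟨ %-distribˡ-* m n N ⟨
    (m * n) % N                 ∎)

  absorb-+ʳ : ∀ m n → fromℕ (m + toℕ (fromℕ n)) ≡ fromℕ (m + n)
  absorb-+ʳ m n = trans (cong fromℕ (+-comm m _)) (trans (absorb-+ n m) (cong fromℕ (+-comm n m)))

  ⊕-assoc : ∀ a b c → (a ⊕ b) ⊕ c ≡ a ⊕ (b ⊕ c)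
  ⊕-assoc a b c = begin
    fromℕ (toℕ (fromℕ (toℕ a + toℕ b)) + toℕ c) ≡⟨ absorb-+ (toℕ a + toℕ b) (toℕ c) ⟩
    fromℕ ((toℕ a + toℕ b) + toℕ c)             ≡⟨ cong fromℕ (+-assoc (toℕ a) (toℕ b) (toℕ c)) ⟩
    fromℕ (toℕ a + (toℕ b + toℕ c))             ≡⟨ absorb-+ʳ (toℕ a) (toℕ b + toℕ c) ⟨
    fromℕ (toℕ a + toℕ (fromℕ (toℕ b + toℕ c))) ∎

  ⊗-assoc : ∀ a b c → (a ⊗ b) ⊗ c ≡ a ⊗ (b ⊗ c)
  ⊗-assoc a b c = begin
    fromℕ (toℕ (fromℕ (toℕ a * toℕ b)) * toℕ c) ≡⟨ absorb-* (toℕ a * toℕ b) (toℕ c) ⟩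
    fromℕ ((toℕ a * toℕ b) * toℕ c)             ≡⟨ cong fromℕ (*-assoc (toℕ a) (toℕ b) (toℕ c)) ⟩
    fromℕ (toℕ a * (toℕ b * toℕ c))             ≡⟨ cong fromℕ (*-comm (toℕ a) _) ⟩
    fromℕ ((toℕ b * toℕ c) * toℕ a)             ≡⟨ absorb-* (toℕ b * toℕ c) (toℕ a) ⟨
    fromℕ (toℕ (fromℕ (toℕ b * toℕ c)) * toℕ a) ≡⟨ cong fromℕ (*-comm _ (toℕ a)) ⟩
    fromℕ (toℕ a * toℕ (fromℕ (toℕ b * toℕ c))) ∎

  ⊕-identityˡ : ∀ a → fromℕ 0 ⊕ a ≡ a
  ⊕-identityˡ a = trans (absorb-+ 0 (toℕ a)) (fromℕ-toℕ a)

  ⊗-identityˡ : ∀ a → fromℕ 1 ⊗ a ≡ a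
  ⊗-identityˡ a = trans (absorb-* 1 (toℕ a)) (trans (cong fromℕ (+-identityʳ (toℕ a))) (fromℕ-toℕ a))

  ⊗-zeroˡ : ∀ a → fromℕ 0 ⊗ a ≡ fromℕ 0
  ⊗-zeroˡ a = absorb-* 0 (toℕ a)

  ⊗-distribʳ-⊕ : ∀ a b c → (b ⊕ c) ⊗ a ≡ (b ⊗ a) ⊕ (c ⊗ a)
  ⊗-distribʳ-⊕ a b c = begin
    fromℕ (toℕ (fromℕ (toℕ b + toℕ c)) * toℕ a)  ≡⟨ absorb-* (toℕ b + toℕ c) (toℕ a) ⟩
    fromℕ ((toℕ b + toℕ c) * toℕ a)              ≡⟨ cong fromℕ (*-distribʳ-+ (toℕ a) (toℕ b) (toℕ c)) ⟩
    fromℕ (toℕ b * toℕ a + toℕ c * toℕ a)        ≡⟨ absorb-+ (toℕ b * toℕ a) _ ⟨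
    fromℕ (toℕ (b ⊗ a) + toℕ c * toℕ a)          ≡⟨ absorb-+ʳ (toℕ (b ⊗ a)) _ ⟨
    fromℕ (toℕ (b ⊗ a) + toℕ (c ⊗ a))            ∎

  isCommutativeSemiring : IsCommutativeSemiring _≡_ _⊕_ _⊗_ (fromℕ 0) (fromℕ 1)
  isCommutativeSemiring = isCommutativeSemiringˡ record
    { +-isCommutativeMonoid = commutativeMonoid _⊕_ (fromℕ 0) ⊕-assoc ⊕-comm ⊕-identityˡ
    ; *-isCommutativeMonoid = commutativeMonoid _⊗_ (fromℕ 1) ⊗-assoc ⊗-comm ⊗-identityˡ
    ; distribʳ = ⊗-distribʳ-⊕
    ; zeroˡ = ⊗-zeroˡ
    }
    where
    ⊕-comm : ∀ a b → a ⊕ b ≡ b ⊕ a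
    ⊕-comm a b = cong fromℕ (+-comm (toℕ a) (toℕ b))
    ⊗-comm : ∀ a b → a ⊗ b ≡ b ⊗ a
    ⊗-comm a b = cong fromℕ (*-comm (toℕ a) (toℕ b))
    open import Algebra.Structures {A = Z} _≡_ using (IsCommutativeMonoid)
    commutativeMonoid : ∀ _∙_ ε → (∀ a b c → (a ∙ b) ∙ c ≡ a ∙ (b ∙ c)) → (∀ a b → a ∙ b ≡ b ∙ a) →
                        (∀ a → ε ∙ a ≡ a) → IsCommutativeMonoid _∙_ ε
    commutativeMonoid _∙_ ε assoc comm idˡ = record
      { isMonoid = record
        { isSemigroup = record { isMagma = record { isEquivalence = isEquivalence ; ∙-cong = cong₂ _∙_ } ; assoc = assoc }
        ; identity = idˡ , λ a → trans (comm a ε) (idˡ a) }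
      ; comm = comm }

module CyclicIndex where

  -- The cyclic predecessor on Fin (n + 1) and the fact that n + 1 of its
  -- iterates give the identity; this is what makes the cyclic shift of
  -- vectors of length n an automorphism of order dividing n.

  open import Data.Nat using (zero; suc; _+_; _*_; _%_)
  open import Data.Nat.Properties using (+-identityʳ; +-suc; +-assoc; +-comm; *-comm; n<1+n; m<n⇒m<1+n)
  open import Data.Nat.DivMod using (m<n⇒m%n≡m; [m+n]%n≡m%n; [m+kn]%n≡m%n; %-distribˡ-+; m%n%n≡m%n)
  open import Data.Fin using (Fin; fromℕ; inject₁; toℕ) renaming (zero to fzero; suc to fsuc)
  open import Data.Fin.Properties using (toℕ-fromℕ; toℕ-inject₁; toℕ-injective; toℕ<n)
  open import Data.Nat.GeneralisedArithmetic using (fold)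
  open import Relation.Binary.PropositionalEquality
  open ≡-Reasoning

  -- i ↦ i - 1 (mod n + 1); it is the index map of the cyclic shift in Defs
  predF : ∀ {n} → Fin (suc n) → Fin (suc n)
  predF {n} fzero = fromℕ n
  predF (fsuc i) = inject₁ i

  toℕ-predF : ∀ {n} (i : Fin (suc n)) → toℕ (predF i) ≡ (toℕ i + n) % suc n
  toℕ-predF {n} fzero = trans (toℕ-fromℕ n) (sym (m<n⇒m%n≡m (n<1+n n)))
  toℕ-predF {n} (fsuc i) = begin
    toℕ (inject₁ i)         ≡⟨ toℕ-inject₁ i ⟩
    toℕ i                   ≡⟨ m<n⇒m%n≡m (m<n⇒m<1+n (toℕ<n i)) ⟨
    toℕ i % suc n           ≡⟨ [m+n]%n≡m%n (toℕ i) (suc n) ⟨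
    (toℕ i + suc n) % suc n ≡⟨ cong (_% suc n) (+-suc (toℕ i) n) ⟩
    (suc (toℕ i) + n) % suc n ∎

  toℕ-predF^ : ∀ {n} k (i : Fin (suc n)) → toℕ (fold i predF k) ≡ (toℕ i + k * n) % suc n
  toℕ-predF^ {n} zero i = trans (sym (m<n⇒m%n≡m (toℕ<n i))) (cong (_% suc n) (sym (+-identityʳ (toℕ i))))
  toℕ-predF^ {n} (suc k) i = begin
    toℕ (predF (fold i predF k))                  ≡⟨ toℕ-predF (fold i predF k) ⟩
    (toℕ (fold i predF k) + n) % suc n            ≡⟨ cong (λ x → (x + n) % suc n) (toℕ-predF^ k i) ⟩
    ((toℕ i + k * n) % suc n + n) % suc n         ≡⟨ %-distribˡ-+ ((toℕ i + k * n) % suc n) n (suc n) ⟩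
    ((toℕ i + k * n) % suc n % suc n + n % suc n) % suc n
      ≡⟨ cong (λ x → (x + n % suc n) % suc n) (m%n%n≡m%n (toℕ i + k * n) (suc n)) ⟩
    ((toℕ i + k * n) % suc n + n % suc n) % suc n ≡⟨ %-distribˡ-+ (toℕ i + k * n) n (suc n) ⟨
    (toℕ i + k * n + n) % suc n                   ≡⟨ cong (_% suc n) (+-assoc (toℕ i) (k * n) n) ⟩
    (toℕ i + (k * n + n)) % suc n                 ≡⟨ cong (λ x → (toℕ i + x) % suc n) (+-comm (k * n) n) ⟩
    (toℕ i + suc k * n) % suc n                   ∎

  predF-order : ∀ {n} (i : Fin (suc n)) → fold i predF (suc n) ≡ i
  predF-order {n} i = toℕ-injective (begin
    toℕ (fold i predF (suc n))  ≡⟨ toℕ-predF^ (suc n) i ⟩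
    (toℕ i + suc n * n) % suc n ≡⟨ cong (λ x → (toℕ i + x) % suc n) (*-comm (suc n) n) ⟩
    (toℕ i + n * suc n) % suc n ≡⟨ [m+kn]%n≡m%n (toℕ i) n (suc n) ⟩
    toℕ i % suc n               ≡⟨ m<n⇒m%n≡m (toℕ<n i) ⟩
    toℕ i                       ∎)

module Cyclic {A : Set} (0# 1# : A) (_⊕_ _⊗_ : A → A → A) (isZero : A → Bool)
  (isCS : IsCommutativeSemiring _≡_ _⊕_ _⊗_ 0# 1#)
  (isZero-sound : ∀ a → isZero a ≡ true → a ≡ 0#) where

  open import Data.Bool using (false)
  open import Relation.Binary.PropositionalEquality
  open CyclicIndex
  open import Data.Nat using (ℕ; zero; suc; _+_; _*_; _≤_; s≤s)
  open import Data.Nat.Properties using (*-comm; *-suc; +-comm; ≤-refl; m≤n⇒m≤1+n; ≤-reflexive; _<?_; ≤-trans; ≮⇒≥; m≤m+n; m≤n+m)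
  open import Data.Nat.GeneralisedArithmetic using (fold; fold-+)
  open import Data.Fin using (Fin; fromℕ; inject₁; toℕ; fromℕ<) renaming (zero to fzero; suc to fsuc)
  open import Data.Fin.Properties using (toℕ-fromℕ; toℕ-inject₁; toℕ-fromℕ<)
  open import Data.List using ([]; _∷_; reverse; _++_; length)
  open import Data.List.Properties using (reverse-involutive; unfold-reverse; length-reverse)
  open import Data.Product using (∃-syntax; _,_)
  open import Data.Maybe using (nothing)
  open import Relation.Nullary using (yes; no)
  open import Relation.Binary.Structures using (IsEquivalence)
  open import Relation.Binary.Bundles using (Setoid)
  open import Algebra.Structures.Biased using (isCommutativeSemiringˡ)
  open import Tactic.RingSolver.Core.AlmostCommutativeRing using (AlmostCommutativeRing)
  open ≡-Reasoning

  open PolyOps 0# 1# _⊕_ _⊗_ isZero public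
  open IsCommutativeSemiring isCS public using ()
    renaming ( +-assoc to ⊕-assoc; +-comm to ⊕-comm; +-identityˡ to ⊕-idˡ; +-identityʳ to ⊕-idʳ
             ; *-assoc to ⊗-assoc; *-comm to ⊗-comm; *-identityˡ to ⊗-idˡ; *-identityʳ to ⊗-idʳ
             ; zeroˡ to ⊗-zeroˡ; zeroʳ to ⊗-zeroʳ; distribˡ to ⊗-distribˡ; distribʳ to ⊗-distribʳ)

  ⊕-interchange : ∀ a b c d → (a ⊕ b) ⊕ (c ⊕ d) ≡ (a ⊕ c) ⊕ (b ⊕ d)
  ⊕-interchange a b c d = begin
    (a ⊕ b) ⊕ (c ⊕ d) ≡⟨ ⊕-assoc a b (c ⊕ d) ⟩
    a ⊕ (b ⊕ (c ⊕ d)) ≡⟨ cong (a ⊕_) (⊕-assoc b c d) ⟨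
    a ⊕ ((b ⊕ c) ⊕ d) ≡⟨ cong (λ x → a ⊕ (x ⊕ d)) (⊕-comm b c) ⟩
    a ⊕ ((c ⊕ b) ⊕ d) ≡⟨ cong (a ⊕_) (⊕-assoc c b d) ⟩
    a ⊕ (c ⊕ (b ⊕ d)) ≡⟨ ⊕-assoc a c (b ⊕ d) ⟨
    (a ⊕ c) ⊕ (b ⊕ d) ∎

  infix 4 _≐_
  _≐_ : ∀ {n} → Vec n → Vec n → Set
  u ≐ v = ∀ i → u i ≡ v i

  ≐-refl : ∀ {n} {u : Vec n} → u ≐ u
  ≐-refl i = refl

  ≐-sym : ∀ {n} {u v : Vec n} → u ≐ v → v ≐ u
  ≐-sym e i = sym (e i)

  ≐-trans : ∀ {n} {u v w : Vec n} → u ≐ v → v ≐ w → u ≐ w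
  ≐-trans e f i = trans (e i) (f i)

  ≐-setoid : ℕ → Setoid _ _
  ≐-setoid n = record { Carrier = Vec n ; _≈_ = _≐_ ; isEquivalence = record { refl = ≐-refl ; sym = ≐-sym ; trans = ≐-trans } }

  +V-cong : ∀ {n} {u u′ v v′ : Vec n} → u ≐ u′ → v ≐ v′ → (u +V v) ≐ (u′ +V v′)
  +V-cong e f i = cong₂ _⊕_ (e i) (f i)

  +V-assoc : ∀ {n} (u v w : Vec n) → ((u +V v) +V w) ≐ (u +V (v +V w))
  +V-assoc u v w i = ⊕-assoc (u i) (v i) (w i)

  +V-comm : ∀ {n} (u v : Vec n) → (u +V v) ≐ (v +V u)
  +V-comm u v i = ⊕-comm (u i) (v i)

  +V-idˡ : ∀ {n} (u : Vec n) → (zeroV +V u) ≐ u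
  +V-idˡ u i = ⊕-idˡ (u i)

  +V-idʳ : ∀ {n} (u : Vec n) → (u +V zeroV) ≐ u
  +V-idʳ u i = ⊕-idʳ (u i)

  +V-interchange : ∀ {n} (a b c d : Vec n) → ((a +V b) +V (c +V d)) ≐ ((a +V c) +V (b +V d))
  +V-interchange a b c d i = ⊕-interchange (a i) (b i) (c i) (d i)

  scaleV-cong : ∀ {n} a {u v : Vec n} → u ≐ v → scaleV a u ≐ scaleV a v
  scaleV-cong a e i = cong (a ⊗_) (e i)

  scaleV-+V : ∀ {n} a (u v : Vec n) → scaleV a (u +V v) ≐ (scaleV a u +V scaleV a v)
  scaleV-+V a u v i = ⊗-distribˡ a (u i) (v i)

  scaleV-⊕ : ∀ {n} a b (u : Vec n) → scaleV (a ⊕ b) u ≐ (scaleV a u +V scaleV b u)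
  scaleV-⊕ a b u i = ⊗-distribʳ (u i) a b

  scaleV-⊗ : ∀ {n} a b (u : Vec n) → scaleV (a ⊗ b) u ≐ scaleV a (scaleV b u)
  scaleV-⊗ a b u i = ⊗-assoc a b (u i)

  scaleV-1 : ∀ {n} (u : Vec n) → scaleV 1# u ≐ u
  scaleV-1 u i = ⊗-idˡ (u i)

  scaleV-0 : ∀ {n} (u : Vec n) → scaleV 0# u ≐ zeroV
  scaleV-0 u i = ⊗-zeroˡ (u i)

  scaleV-zero : ∀ {n} a → scaleV {n} a zeroV ≐ zeroV
  scaleV-zero a i = ⊗-zeroʳ a

  scaleV-comm : ∀ {n} a b (u : Vec n) → scaleV a (scaleV b u) ≐ scaleV b (scaleV a u)
  scaleV-comm a b u i = begin
    a ⊗ (b ⊗ u i) ≡⟨ ⊗-assoc a b (u i) ⟨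
    (a ⊗ b) ⊗ u i ≡⟨ cong (_⊗ u i) (⊗-comm a b) ⟩
    (b ⊗ a) ⊗ u i ≡⟨ ⊗-assoc b a (u i) ⟩
    b ⊗ (a ⊗ u i) ∎

  iter : ∀ {X : Set} → (X → X) → ℕ → X → X
  iter f k x = fold x f k

  iter-+ : ∀ {X : Set} (f : X → X) a b x → iter f (a + b) x ≡ iter f a (iter f b x)
  iter-+ f a b x = fold-+ x f a

  iter-* : ∀ {X : Set} (f : X → X) a b x → iter (iter f b) a x ≡ iter f (a * b) x
  iter-* f zero b x = refl
  iter-* f (suc a) b x = trans (cong (iter f b) (iter-* f a b x)) (sym (iter-+ f b (a * b) x))

  iter-comm : ∀ {X : Set} (f : X → X) a b x → iter f a (iter f b x) ≡ iter f b (iter f a x)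
  iter-comm f a b x = trans (sym (iter-+ f a b x)) (trans (cong (λ m → iter f m x) (+-comm a b)) (iter-+ f b a x))

  iter-step : ∀ {X : Set} (f : X → X) k x → iter f k (f x) ≡ f (iter f k x)
  iter-step f zero x = refl
  iter-step f (suc k) x = cong f (iter-step f k x)

  -- Sums and products of polynomials become
  -- sums and composites of operators, so polynomial identities modulo
  -- "acts as zero" can be discharged by the ring solver.

  module LinearOperator {n : ℕ} (T : Vec n → Vec n)
    (T-cong : ∀ {u v} → u ≐ v → T u ≐ T v)
    (T-+ : ∀ u v → T (u +V v) ≐ (T u +V T v))
    (T-scale : ∀ a u → T (scaleV a u) ≐ scaleV a (T u)) where

    T-zero : T zeroV ≐ zeroV
    T-zero = ≐-trans (T-cong (≐-sym (scaleV-0 zeroV))) (≐-trans (T-scale 0# zeroV) (scaleV-0 _))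

    iterT-cong : ∀ k {u v} → u ≐ v → iter T k u ≐ iter T k v
    iterT-cong zero e = e
    iterT-cong (suc k) e = T-cong (iterT-cong k e)

    iterT-+ : ∀ k u v → iter T k (u +V v) ≐ (iter T k u +V iter T k v)
    iterT-+ zero u v = ≐-refl
    iterT-+ (suc k) u v = ≐-trans (T-cong (iterT-+ k u v)) (T-+ _ _)

    iterT-scale : ∀ k a u → iter T k (scaleV a u) ≐ scaleV a (iter T k u)
    iterT-scale zero a u = ≐-refl
    iterT-scale (suc k) a u = ≐-trans (T-cong (iterT-scale k a u)) (T-scale _ _)

    iterT-order-* : ∀ {m} → (∀ v → iter T m v ≐ v) → ∀ k v → iter T (k * m) v ≐ v
    iterT-order-* ord zero v = ≐-refl
    iterT-order-* {m} ord (suc k) v i =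
      trans (cong (λ x → x i) (iter-+ T m (k * m) v)) (trans (iterT-cong m (iterT-order-* ord k v) i) (ord v i))

    iterT-zero : ∀ k → iter T k zeroV ≐ zeroV
    iterT-zero zero = ≐-refl
    iterT-zero (suc k) = ≐-trans (T-cong (iterT-zero k)) T-zero

    actT : Poly → Vec n → Vec n
    actT [] v = zeroV
    actT (a ∷ p) v = scaleV a v +V T (actT p v)

    actT-cong : ∀ p {u v} → u ≐ v → actT p u ≐ actT p v
    actT-cong [] e = ≐-refl
    actT-cong (a ∷ p) e = +V-cong (scaleV-cong a e) (T-cong (actT-cong p e))

    actT-zero : ∀ p → actT p zeroV ≐ zeroV
    actT-zero [] = ≐-refl
    actT-zero (a ∷ p) = ≐-trans (+V-cong (scaleV-zero a) (≐-trans (T-cong (actT-zero p)) T-zero)) (+V-idˡ zeroV)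

    actT-+V : ∀ p u v → actT p (u +V v) ≐ (actT p u +V actT p v)
    actT-+V [] u v = ≐-sym (+V-idˡ zeroV)
    actT-+V (a ∷ p) u v = ≐-trans (+V-cong (scaleV-+V a u v) (≐-trans (T-cong (actT-+V p u v)) (T-+ _ _)))
                            (+V-interchange _ _ _ _)

    actT-scale : ∀ p a u → actT p (scaleV a u) ≐ scaleV a (actT p u)
    actT-scale [] a u = ≐-sym (scaleV-zero a)
    actT-scale (b ∷ p) a u = ≐-trans (+V-cong (scaleV-comm b a u) (≐-trans (T-cong (actT-scale p a u)) (T-scale a _)))
                               (≐-sym (scaleV-+V a _ _))

    actT-T : ∀ p u → actT p (T u) ≐ T (actT p u)
    actT-T [] u = ≐-sym T-zero
    actT-T (a ∷ p) u = ≐-trans (+V-cong (≐-sym (T-scale a u)) (T-cong (actT-T p u))) (≐-sym (T-+ _ _))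

    actT-+P : ∀ p q u → actT (p +P q) u ≐ (actT p u +V actT q u)
    actT-+P [] q u = ≐-sym (+V-idˡ _)
    actT-+P (a ∷ p) [] u = ≐-sym (+V-idʳ _)
    actT-+P (a ∷ p) (b ∷ q) u =
      ≐-trans (+V-cong (scaleV-⊕ a b u) (≐-trans (T-cong (actT-+P p q u)) (T-+ _ _))) (+V-interchange _ _ _ _)

    actT-scaleP : ∀ a p u → actT (scaleP a p) u ≐ scaleV a (actT p u)
    actT-scaleP a [] u = ≐-sym (scaleV-zero a)
    actT-scaleP a (b ∷ p) u =
      ≐-trans (+V-cong (scaleV-⊗ a b u) (≐-trans (T-cong (actT-scaleP a p u)) (T-scale a _))) (≐-sym (scaleV-+V a _ _))

    actT-0∷ : ∀ p u → actT (0# ∷ p) u ≐ T (actT p u)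
    actT-0∷ p u = ≐-trans (+V-cong (scaleV-0 u) ≐-refl) (+V-idˡ _)

    actT-*P : ∀ p q u → actT (p *P q) u ≐ actT p (actT q u)
    actT-*P [] q u = ≐-refl
    actT-*P (a ∷ p) q u =
      ≐-trans (actT-+P (scaleP a q) (0# ∷ (p *P q)) u)
        (+V-cong (actT-scaleP a q u) (≐-trans (actT-0∷ (p *P q) u) (T-cong (actT-*P p q u))))

    actT-comm : ∀ p q u → actT p (actT q u) ≐ actT q (actT p u)
    actT-comm p [] u = actT-zero p
    actT-comm p (b ∷ q) u =
      ≐-trans (actT-+V p _ _) (+V-cong (actT-scale p b u) (≐-trans (actT-T p _) (T-cong (actT-comm p q u))))

    actT-≈0 : ∀ p u → (∀ i → coeff p i ≡ 0#) → actT p u ≐ zeroV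
    actT-≈0 [] u e = ≐-refl
    actT-≈0 (a ∷ p) u e rewrite e 0 =
      ≐-trans (actT-0∷ p u) (≐-trans (T-cong (actT-≈0 p u (λ i → e (suc i)))) T-zero)

    actT-≈P : ∀ p q u → p ≈P q → actT p u ≐ actT q u
    actT-≈P [] [] u e = ≐-refl
    actT-≈P [] (b ∷ q) u e = ≐-sym (actT-≈0 (b ∷ q) u (λ i → sym (e i)))
    actT-≈P (a ∷ p) [] u e = actT-≈0 (a ∷ p) u e
    actT-≈P (a ∷ p) (b ∷ q) u e rewrite e 0 =
      +V-cong ≐-refl (T-cong (actT-≈P p q u (λ i → e (suc i))))

    actT-X^ : ∀ k u → actT (X^ k) u ≐ iter T k u
    actT-X^ zero u = ≐-trans (+V-cong (scaleV-1 u) T-zero) (+V-idʳ u)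
    actT-X^ (suc k) u = ≐-trans (actT-0∷ (X^ k) u) (T-cong (actT-X^ k u))

    actT-one : ∀ u → actT (1# ∷ []) u ≐ u
    actT-one u = actT-X^ 0 u

    actT-const : ∀ a u → actT (a ∷ []) u ≐ scaleV a u
    actT-const a u = ≐-trans (+V-cong ≐-refl T-zero) (+V-idʳ _)

    infix 4 _~_
    record _~_ (p q : Poly) : Set where
      constructor mk~
      field run~ : ∀ v → actT p v ≐ actT q v
    open _~_ public

    ~-refl : ∀ {p} → p ~ p
    ~-refl = mk~ λ v → ≐-refl

    ~-sym : ∀ {p q} → p ~ q → q ~ p
    ~-sym e = mk~ λ v → ≐-sym (run~ e v)

    ~-trans : ∀ {p q r} → p ~ q → q ~ r → p ~ r
    ~-trans e f = mk~ λ v → ≐-trans (run~ e v) (run~ f v)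

    ~-isEquivalence : IsEquivalence _~_
    ~-isEquivalence = record { refl = λ {p} → ~-refl {p} ; sym = λ {p} {q} → ~-sym {p} {q} ; trans = λ {p} {q} {r} → ~-trans {p} {q} {r} }

    +P-cong~ : ∀ {p p′ q q′} → p ~ p′ → q ~ q′ → (p +P q) ~ (p′ +P q′)
    +P-cong~ {p} {p′} {q} {q′} e f =
      mk~ λ v → ≐-trans (actT-+P p q v) (≐-trans (+V-cong (run~ e v) (run~ f v)) (≐-sym (actT-+P p′ q′ v)))

    *P-cong~ : ∀ {p p′ q q′} → p ~ p′ → q ~ q′ → (p *P q) ~ (p′ *P q′)
    *P-cong~ {p} {p′} {q} {q′} e f =
      mk~ λ v → ≐-trans (actT-*P p q v) (≐-trans (actT-cong p (run~ f v)) (≐-trans (run~ e _) (≐-sym (actT-*P p′ q′ v))))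

    ≈P⇒~ : ∀ {p q} → p ≈P q → p ~ q
    ≈P⇒~ {p} {q} e = mk~ λ v → actT-≈P p q v e

    isCommutativeSemiring~ : IsCommutativeSemiring _~_ _+P_ _*P_ [] (1# ∷ [])
    isCommutativeSemiring~ = isCommutativeSemiringˡ record
      { +-isCommutativeMonoid = record
        { isMonoid = record
          { isSemigroup = record
            { isMagma = record { isEquivalence = ~-isEquivalence ; ∙-cong = λ {p} {p′} {q} {q′} → +P-cong~ {p} {p′} {q} {q′} }
            ; assoc = λ p q r → mk~ λ v → ≐-trans (actT-+P (p +P q) r v) (≐-trans (+V-cong (actT-+P p q v) ≐-refl)
                        (≐-trans (+V-assoc _ _ _) (≐-sym (≐-trans (actT-+P p (q +P r) v) (+V-cong ≐-refl (actT-+P q r v)))))) }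
          ; identity = (λ p → ~-refl {p}) , (λ p → mk~ λ v → ≐-trans (actT-+P p [] v) (+V-idʳ _)) }
        ; comm = λ p q → mk~ λ v → ≐-trans (actT-+P p q v) (≐-trans (+V-comm _ _) (≐-sym (actT-+P q p v))) }
      ; *-isCommutativeMonoid = record
        { isMonoid = record
          { isSemigroup = record
            { isMagma = record { isEquivalence = ~-isEquivalence ; ∙-cong = λ {p} {p′} {q} {q′} → *P-cong~ {p} {p′} {q} {q′} }
            ; assoc = λ p q r → mk~ λ v → ≐-trans (actT-*P (p *P q) r v) (≐-trans (actT-*P p q _)
                        (≐-sym (≐-trans (actT-*P p (q *P r) v) (actT-cong p (actT-*P q r v))))) }
          ; identity = (λ p → mk~ λ v → ≐-trans (actT-*P (1# ∷ []) p v) (actT-one _)) ,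
                       (λ p → mk~ λ v → ≐-trans (actT-*P p (1# ∷ []) v) (actT-cong p (actT-one v))) }
        ; comm = λ p q → mk~ λ v → ≐-trans (actT-*P p q v) (≐-trans (actT-comm p q v) (≐-sym (actT-*P q p v))) }
      ; distribʳ = λ p q r → mk~ λ v → ≐-trans (actT-*P (q +P r) p v) (≐-trans (actT-+P q r _)
                     (≐-sym (≐-trans (actT-+P (q *P p) (r *P p) v) (+V-cong (actT-*P q p v) (actT-*P r p v)))))
      ; zeroˡ = λ p → ~-refl {[] *P p}
      }

    -- the same, packaged for the ring solver
    operatorRing : AlmostCommutativeRing _ _
    operatorRing = record
      { Carrier = Poly ; _≈_ = _~_ ; _+_ = _+P_ ; _*_ = _*P_ ; -_ = λ x → x ; 0# = [] ; 0≟_ = λ _ → nothing ; 1# = 1# ∷ []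
      ; isAlmostCommutativeRing = record
        { isCommutativeSemiring = isCommutativeSemiring~
        ; -‿cong = λ e → e
        ; -‿*-distribˡ = λ x y → ~-refl {x *P y}
        ; -‿+-comm = λ x y → ~-refl {x +P y} } }

  shift-cong : ∀ {n} {u v : Vec n} → u ≐ v → shift u ≐ shift v
  shift-cong {zero} e i = e i
  shift-cong {suc n} e fzero = e (fromℕ n)
  shift-cong {suc n} e (fsuc i) = e (inject₁ i)

  shift-+ : ∀ {n} (u v : Vec n) → shift (u +V v) ≐ (shift u +V shift v)
  shift-+ {zero} u v i = refl
  shift-+ {suc n} u v fzero = refl
  shift-+ {suc n} u v (fsuc i) = refl

  shift-scale : ∀ {n} a (u : Vec n) → shift (scaleV a u) ≐ scaleV a (shift u)
  shift-scale {zero} a u i = refl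
  shift-scale {suc n} a u fzero = refl
  shift-scale {suc n} a u (fsuc i) = refl

  module S {n : ℕ} = LinearOperator {n} shift shift-cong shift-+ shift-scale

  shift-predF : ∀ {n} (v : Vec (suc n)) i → shift v i ≡ v (predF i)
  shift-predF v fzero = refl
  shift-predF v (fsuc i) = refl

  iter-shift-predF : ∀ {n} k (v : Vec (suc n)) i → iter shift k v i ≡ v (iter predF k i)
  iter-shift-predF zero v i = refl
  iter-shift-predF (suc k) v i = begin
    shift (iter shift k v) i        ≡⟨ shift-predF (iter shift k v) i ⟩
    iter shift k v (predF i)        ≡⟨ iter-shift-predF k v (predF i) ⟩
    v (iter predF k (predF i))      ≡⟨ cong v (iter-step predF k i) ⟩
    v (predF (iter predF k i))      ∎

  shift-order : ∀ {n} (v : Vec n) → iter shift n v ≐ v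
  shift-order {zero} v ()
  shift-order {suc n} v i = trans (iter-shift-predF (suc n) v i) (cong v (predF-order i))

  unshift : ∀ {n} → Vec n → Vec n
  unshift {zero} v = v
  unshift {suc n} v = iter shift n v

  unshift-cong : ∀ {n} {u v : Vec n} → u ≐ v → unshift u ≐ unshift v
  unshift-cong {zero} e = e
  unshift-cong {suc n} e = S.iterT-cong n e

  unshift-+ : ∀ {n} (u v : Vec n) → unshift (u +V v) ≐ (unshift u +V unshift v)
  unshift-+ {zero} u v = ≐-refl
  unshift-+ {suc n} u v = S.iterT-+ n u v

  unshift-scale : ∀ {n} a (u : Vec n) → unshift (scaleV a u) ≐ scaleV a (unshift u)
  unshift-scale {zero} a u = ≐-refl
  unshift-scale {suc n} a u = S.iterT-scale n a u

  shift-unshift : ∀ {n} (v : Vec n) → shift (unshift v) ≐ v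
  shift-unshift {zero} v = ≐-refl
  shift-unshift {suc n} v = shift-order v

  unshift-shift : ∀ {n} (v : Vec n) → unshift (shift v) ≐ v
  unshift-shift {zero} v = ≐-refl
  unshift-shift {suc n} v i = trans (cong (λ x → x i) (iter-step shift n v)) (shift-order v i)

  module U {n : ℕ} = LinearOperator {n} unshift unshift-cong unshift-+ unshift-scale

  iter-shift-injective : ∀ {n} k (w : Vec n) → iter shift k w ≐ zeroV → w ≐ zeroV
  iter-shift-injective zero w e = e
  iter-shift-injective (suc k) w e =
    iter-shift-injective k w (≐-trans (≐-sym (unshift-shift _)) (≐-trans (unshift-cong e) U.T-zero))

  unshift-order : ∀ {n} (v : Vec n) → iter unshift n v ≐ v
  unshift-order {zero} v = ≐-refl
  unshift-order {suc n} v i = begin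
    iter unshift (suc n) v i   ≡⟨ cong (λ x → x i) (iter-* shift (suc n) n v) ⟩
    iter shift (suc n * n) v i ≡⟨ cong (λ m → iter shift m v i) (*-comm (suc n) n) ⟩
    iter shift (n * suc n) v i ≡⟨ S.iterT-order-* shift-order n v i ⟩
    v i                        ∎

  unshift-as-shift : ∀ {m} (w : Vec (suc m)) → iter unshift m w ≐ shift w
  unshift-as-shift {m} w = ≐-trans (U.iterT-cong m (≐-sym (unshift-shift w)))
                             (≐-trans (λ i → cong (λ x → x i) (iter-step unshift m (shift w))) (unshift-order (shift w)))

  iter-unshift-as-shift : ∀ {m} k (w : Vec (suc m)) → iter unshift (k * m) w ≐ iter shift k w
  iter-unshift-as-shift {m} k w = ≐-trans (λ i → cong (λ x → x i) (sym (iter-* unshift k m w))) (go k w)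
    where
    go : ∀ k w → iter (iter unshift m) k w ≐ iter shift k w
    go zero w = ≐-refl
    go (suc k) w = ≐-trans (unshift-as-shift _) (shift-cong (go k w))

  act≐actS : ∀ {n} p (v : Vec n) → act p v ≐ S.actT p v
  act≐actS [] v = ≐-refl
  act≐actS (a ∷ p) v = +V-cong ≐-refl (shift-cong (act≐actS p v))

  sumV-cong : ∀ {n} {u v : Vec n} → u ≐ v → sumV u ≡ sumV v
  sumV-cong {zero} e = refl
  sumV-cong {suc n} e = cong₂ _⊕_ (e fzero) (sumV-cong (λ i → e (fsuc i)))

  sumV-+V : ∀ {n} (u v : Vec n) → sumV (u +V v) ≡ sumV u ⊕ sumV v
  sumV-+V {zero} u v = sym (⊕-idˡ 0#)
  sumV-+V {suc n} u v = trans (cong (_ ⊕_) (sumV-+V (λ i → u (fsuc i)) (λ i → v (fsuc i)))) (⊕-interchange _ _ _ _)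

  sumV-scale : ∀ {n} a (u : Vec n) → sumV (scaleV a u) ≡ a ⊗ sumV u
  sumV-scale {zero} a u = sym (⊗-zeroʳ a)
  sumV-scale {suc n} a u = trans (cong (_ ⊕_) (sumV-scale a (λ i → u (fsuc i)))) (sym (⊗-distribˡ a _ _))

  sumV-zero : ∀ {n} → sumV {n} zeroV ≡ 0#
  sumV-zero {zero} = refl
  sumV-zero {suc n} = trans (cong (0# ⊕_) (sumV-zero {n})) (⊕-idˡ 0#)

  sumV-last : ∀ {n} (f : Vec (suc n)) → sumV f ≡ sumV (λ j → f (inject₁ j)) ⊕ f (fromℕ n)
  sumV-last {zero} f = ⊕-comm _ _
  sumV-last {suc n} f = trans (cong (f fzero ⊕_) (sumV-last (λ j → f (fsuc j)))) (sym (⊕-assoc _ _ _))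

  sumV-predF : ∀ {n} (f : Vec (suc n)) → sumV (λ i → f (predF i)) ≡ sumV f
  sumV-predF f = trans (⊕-comm _ _) (sym (sumV-last f))

  dot : ∀ {n} → Vec n → Vec n → A
  dot u w = sumV (λ i → u i ⊗ w i)

  dot-cong : ∀ {n} {u u′ w w′ : Vec n} → u ≐ u′ → w ≐ w′ → dot u w ≡ dot u′ w′
  dot-cong e f = sumV-cong (λ i → cong₂ _⊗_ (e i) (f i))

  dot-+ˡ : ∀ {n} (u v w : Vec n) → dot (u +V v) w ≡ dot u w ⊕ dot v w
  dot-+ˡ u v w = trans (sumV-cong (λ i → ⊗-distribʳ (w i) (u i) (v i))) (sumV-+V (λ i → u i ⊗ w i) (λ i → v i ⊗ w i))

  dot-+ʳ : ∀ {n} (u v w : Vec n) → dot u (v +V w) ≡ dot u v ⊕ dot u w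
  dot-+ʳ u v w = trans (sumV-cong (λ i → ⊗-distribˡ (u i) (v i) (w i))) (sumV-+V (λ i → u i ⊗ v i) (λ i → u i ⊗ w i))

  dot-scaleˡ : ∀ {n} a (u w : Vec n) → dot (scaleV a u) w ≡ a ⊗ dot u w
  dot-scaleˡ a u w = trans (sumV-cong (λ i → ⊗-assoc a (u i) (w i))) (sumV-scale a (λ i → u i ⊗ w i))

  dot-scaleʳ : ∀ {n} a (u w : Vec n) → dot u (scaleV a w) ≡ a ⊗ dot u w
  dot-scaleʳ a u w = trans (sumV-cong swap) (sumV-scale a (λ i → u i ⊗ w i))
    where
    swap : ∀ i → u i ⊗ (a ⊗ w i) ≡ a ⊗ (u i ⊗ w i)
    swap i = trans (sym (⊗-assoc (u i) a (w i))) (trans (cong (_⊗ w i) (⊗-comm (u i) a)) (⊗-assoc a (u i) (w i)))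

  dot-zeroˡ : ∀ {n} (w : Vec n) → dot zeroV w ≡ 0#
  dot-zeroˡ {n} w = trans (sumV-cong (λ i → ⊗-zeroˡ (w i))) (sumV-zero {n})

  dot-zeroʳ : ∀ {n} (u : Vec n) → dot u zeroV ≡ 0#
  dot-zeroʳ {n} u = trans (sumV-cong (λ i → ⊗-zeroʳ (u i))) (sumV-zero {n})

  dot-shift : ∀ {n} (u w : Vec n) → dot (shift u) w ≡ dot u (unshift w)
  dot-shift {zero} u w = refl
  dot-shift {suc n} u w = begin
    dot (shift u) w                                  ≡⟨ dot-cong (≐-refl {u = shift u}) (≐-sym (shift-unshift w)) ⟩
    dot (shift u) (shift (unshift w))                ≡⟨ sumV-cong (λ i → cong₂ _⊗_ (shift-predF u i) (shift-predF (unshift w) i)) ⟩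
    sumV (λ i → u (predF i) ⊗ unshift w (predF i))   ≡⟨ sumV-predF (λ i → u i ⊗ unshift w i) ⟩
    dot u (unshift w)                                ∎

  adjoint : ∀ {n} p (u w : Vec n) → dot (S.actT p u) w ≡ dot u (U.actT p w)
  adjoint [] u w = trans (dot-zeroˡ w) (sym (dot-zeroʳ u))
  adjoint (a ∷ p) u w = begin
    dot (scaleV a u +V shift (S.actT p u)) w                ≡⟨ dot-+ˡ _ _ w ⟩
    dot (scaleV a u) w ⊕ dot (shift (S.actT p u)) w         ≡⟨ cong₂ _⊕_ (dot-scaleˡ a u w) (dot-shift _ w) ⟩
    (a ⊗ dot u w) ⊕ dot (S.actT p u) (unshift w)            ≡⟨ cong (_ ⊕_) (adjoint p u (unshift w)) ⟩
    (a ⊗ dot u w) ⊕ dot u (U.actT p (unshift w))            ≡⟨ cong (_ ⊕_) (dot-cong ≐-refl (U.actT-T p w)) ⟩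
    (a ⊗ dot u w) ⊕ dot u (unshift (U.actT p w))            ≡⟨ cong (_⊕ _) (dot-scaleʳ a u w) ⟨
    dot u (scaleV a w) ⊕ dot u (unshift (U.actT p w))       ≡⟨ dot-+ʳ u _ _ ⟨
    dot u (scaleV a w +V unshift (U.actT p w))              ∎

  basis : ∀ {n} → Fin n → Vec n
  basis fzero fzero = 1#
  basis fzero (fsuc i) = 0#
  basis (fsuc j) fzero = 0#
  basis (fsuc j) (fsuc i) = basis j i

  dot-basis : ∀ {n} (j : Fin n) (y : Vec n) → dot (basis j) y ≡ y j
  dot-basis {suc n} fzero y =
    trans (cong₂ _⊕_ (⊗-idˡ (y fzero)) (trans (sumV-cong (λ i → ⊗-zeroˡ (y (fsuc i)))) (sumV-zero {n}))) (⊕-idʳ _)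
  dot-basis {suc n} (fsuc j) y = trans (cong₂ _⊕_ (⊗-zeroˡ (y fzero)) (dot-basis j (λ i → y (fsuc i)))) (⊕-idˡ _)

  dot-nondegenerate : ∀ {n} (y : Vec n) → (∀ u → dot u y ≡ 0#) → y ≐ zeroV
  dot-nondegenerate y h j = trans (sym (dot-basis j y)) (h (basis j))

  coeff-beyond : ∀ p k → length p ≤ k → coeff p k ≡ 0#
  coeff-beyond [] k le = refl
  coeff-beyond (a ∷ p) (suc k) (s≤s le) = coeff-beyond p k le

  embed-coeff : ∀ {n} p → length p ≤ n → ∀ (i : Fin n) → S.actT p e₀ i ≡ coeff p (toℕ i)
  embed-coeff [] le i = refl
  embed-coeff {suc m} (a ∷ p) (s≤s le) fzero =
    trans (cong₂ _⊕_ (⊗-idʳ a) (trans (embed-coeff p (m≤n⇒m≤1+n le) (fromℕ m))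
                     (trans (cong (coeff p) (toℕ-fromℕ m)) (coeff-beyond p m le)))) (⊕-idʳ a)
  embed-coeff {suc m} (a ∷ p) (s≤s le) (fsuc j) =
    trans (cong₂ _⊕_ (⊗-zeroʳ a) (trans (embed-coeff p (m≤n⇒m≤1+n le) (inject₁ j)) (cong (coeff p) (toℕ-inject₁ j))))
          (⊕-idˡ _)

  length-+P : ∀ p q k → length p ≤ k → length q ≤ k → length (p +P q) ≤ k
  length-+P [] q k lp lq = lq
  length-+P (a ∷ p) [] k lp lq = lp
  length-+P (a ∷ p) (b ∷ q) (suc k) (s≤s lp) (s≤s lq) = s≤s (length-+P p q k lp lq)

  toPoly : ∀ {n} → Vec n → Poly
  toPoly {zero} v = []
  toPoly {suc n} v = v fzero ∷ toPoly (λ i → v (fsuc i))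

  length-toPoly : ∀ {n} (v : Vec n) → length (toPoly v) ≡ n
  length-toPoly {zero} v = refl
  length-toPoly {suc n} v = cong suc (length-toPoly (λ i → v (fsuc i)))

  coeff-toPoly : ∀ {n} (v : Vec n) i → coeff (toPoly v) (toℕ i) ≡ v i
  coeff-toPoly {suc n} v fzero = refl
  coeff-toPoly {suc n} v (fsuc i) = coeff-toPoly (λ j → v (fsuc j)) i

  embed-toPoly : ∀ {n} (v : Vec n) → S.actT (toPoly v) e₀ ≐ v
  embed-toPoly v i = trans (embed-coeff (toPoly v) (≤-reflexive (length-toPoly v)) i) (coeff-toPoly v i)

  short-embed-injective : ∀ n p q → length p ≤ n → length q ≤ n → S.actT {n} p e₀ ≐ S.actT q e₀ → p ≈P q
  short-embed-injective n p q lp lq e k with k <? n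
  ... | yes k<n = begin
    coeff p k                       ≡⟨ cong (coeff p) (toℕ-fromℕ< k<n) ⟨
    coeff p (toℕ (fromℕ< k<n))      ≡⟨ embed-coeff p lp (fromℕ< k<n) ⟨
    S.actT p e₀ (fromℕ< k<n)        ≡⟨ e (fromℕ< k<n) ⟩
    S.actT q e₀ (fromℕ< k<n)        ≡⟨ embed-coeff q lq (fromℕ< k<n) ⟩
    coeff q (toℕ (fromℕ< k<n))      ≡⟨ cong (coeff q) (toℕ-fromℕ< k<n) ⟩
    coeff q k                       ∎
  ... | no k≮n = trans (coeff-beyond p k (≤-trans lp (≮⇒≥ k≮n))) (sym (coeff-beyond q k (≤-trans lq (≮⇒≥ k≮n))))

  actS-injective : ∀ p q → (∀ {n} (v : Vec n) → S.actT p v ≐ S.actT q v) → p ≈P q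
  actS-injective p q h = short-embed-injective _ p q (m≤m+n _ _) (m≤n+m _ _) (h e₀)

  -- a copy of the private helper of Defs.recip (drop leading zeros), so that
  -- recip p can be unfolded
  dropZeros′ : Poly → Poly
  dropZeros′ [] = []
  dropZeros′ (a ∷ p) with isZero a
  ... | true = dropZeros′ p
  ... | false = a ∷ p

  recip-unfold : ∀ (k : ℕ) p → length (reverse p) ≤ k → recip p ≡ dropZeros′ (reverse p)
  recip-unfold k p with reverse p
  ... | [] = λ _ → refl
  recip-unfold k p | a ∷ N with isZero a
  ... | false = λ _ → refl
  recip-unfold (suc k) p | a ∷ N | true with reverse (reverse N) | reverse-involutive N | recip-unfold k (reverse N)
  ... | .N | refl | ih = λ { (s≤s le) → ih le }

  recip≡dropZeros′ : ∀ p → recip p ≡ dropZeros′ (reverse p)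
  recip≡dropZeros′ p = recip-unfold _ p ≤-refl

  actS-++ : ∀ {n} L M (v : Vec n) → S.actT (L ++ M) v ≐ (S.actT L v +V iter shift (length L) (S.actT M v))
  actS-++ [] M v = ≐-sym (+V-idˡ _)
  actS-++ (a ∷ L) M v = ≐-trans (+V-cong ≐-refl (≐-trans (shift-cong (actS-++ L M v)) (shift-+ _ _)))
                                (≐-sym (+V-assoc _ _ _))

  actS-dropZeros′ : ∀ {n} M → ∃[ z ] (∀ (v : Vec n) → S.actT M v ≐ iter shift z (S.actT (dropZeros′ M) v))
  actS-dropZeros′ [] = 0 , λ v → ≐-refl
  actS-dropZeros′ (a ∷ M) with isZero a in eq
  ... | false = 0 , λ v → ≐-refl
  ... | true with actS-dropZeros′ M
  ... | z , h = suc z , λ v → ≐-trans (+V-cong (λ i → cong (_⊗ v i) (isZero-sound a eq)) ≐-refl)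
                              (≐-trans (+V-cong (scaleV-0 v) ≐-refl) (≐-trans (+V-idˡ _) (shift-cong (h v))))

  actU-reverse : ∀ {n} L (v : Vec n) → iter shift (length L) (U.actT L v) ≐ shift (S.actT (reverse L) v)
  actU-reverse [] v = ≐-sym S.T-zero
  actU-reverse (a ∷ L) v =
    ≐-trans (S.iterT-+ (suc k) _ _) (≐-trans (+V-cong ≐-refl tail) (≐-trans (+V-comm _ _) (≐-sym (≐-trans (shift-cong head) (shift-+ _ _)))))
    where
    k : ℕ
    k = length L
    head : S.actT (reverse (a ∷ L)) v ≐ (S.actT (reverse L) v +V iter shift k (scaleV a v))
    head = ≐-trans (λ i → cong (λ p → S.actT p v i) (unfold-reverse a L))
             (≐-trans (actS-++ (reverse L) (a ∷ []) v)
               (+V-cong ≐-refl (λ i → trans (cong (λ m → iter shift m (S.actT (a ∷ []) v) i) (length-reverse L))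
                                         (S.iterT-cong k (S.actT-const a v) i))))
    tail : iter shift (suc k) (unshift (U.actT L v)) ≐ shift (S.actT (reverse L) v)
    tail = ≐-trans (λ i → cong (λ x → x i) (sym (iter-step shift k (unshift (U.actT L v)))))
             (≐-trans (S.iterT-cong k (shift-unshift (U.actT L v))) (actU-reverse L v))

  actU-recip : ∀ {n} p → ∃[ k ] (∀ (v : Vec n) → U.actT p v ≐ iter shift k (S.actT (recip p) v))
  actU-recip {zero} p = 0 , λ v ()
  actU-recip {suc n} p with actS-dropZeros′ {suc n} (reverse p)
  ... | z , h = L * n + suc z , λ v → begin≐ v
    where
    L : ℕ
    L = length p
    begin≐ : ∀ v → U.actT p v ≐ iter shift (L * n + suc z) (S.actT (recip p) v)
    begin≐ v =
      ≐-trans (≐-sym (S.iterT-order-* shift-order L (U.actT p v)))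
      (≐-trans (λ i → trans (cong (λ m → iter shift m (U.actT p v) i) (*-suc L n))
                      (trans (cong (λ x → x i) (iter-+ shift L (L * n) (U.actT p v)))
                       (cong (λ x → x i) (iter-comm shift L (L * n) (U.actT p v)))))
      (≐-trans (S.iterT-cong (L * n) (actU-reverse p v))
      (≐-trans (S.iterT-cong (L * n) (shift-cong (h v)))
      (λ i → trans (cong (λ q → iter shift (L * n) (shift (iter shift z (S.actT q v))) i) (sym (recip≡dropZeros′ p)))
               (sym (cong (λ x → x i) (iter-+ shift (L * n) (suc z) _)))))))

module Rings where

  open import Data.Nat using (zero; suc; _%_)
  open import Data.Bool using (true)
  open import Relation.Binary.PropositionalEquality

  fromℕ₂-toℕ₂ : ∀ a → fromℕ₂ (toℕ₂ a) ≡ a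
  fromℕ₂-toℕ₂ 0₂ = refl
  fromℕ₂-toℕ₂ 1₂ = refl
  toℕ₂-fromℕ₂ : ∀ n → toℕ₂ (fromℕ₂ n) ≡ n % 2
  toℕ₂-fromℕ₂ zero = refl
  toℕ₂-fromℕ₂ (suc zero) = refl
  toℕ₂-fromℕ₂ (suc (suc n)) = toℕ₂-fromℕ₂ n
  fromℕ₂-% : ∀ n → fromℕ₂ (n % 2) ≡ fromℕ₂ n
  fromℕ₂-% zero = refl
  fromℕ₂-% (suc zero) = refl
  fromℕ₂-% (suc (suc n)) = fromℕ₂-% n

  fromℕ₄-toℕ₄ : ∀ a → fromℕ₄ (toℕ₄ a) ≡ a
  fromℕ₄-toℕ₄ 0₄ = refl
  fromℕ₄-toℕ₄ 1₄ = refl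
  fromℕ₄-toℕ₄ 2₄ = refl
  fromℕ₄-toℕ₄ 3₄ = refl
  toℕ₄-fromℕ₄ : ∀ n → toℕ₄ (fromℕ₄ n) ≡ n % 4
  toℕ₄-fromℕ₄ zero = refl
  toℕ₄-fromℕ₄ (suc zero) = refl
  toℕ₄-fromℕ₄ (suc (suc zero)) = refl
  toℕ₄-fromℕ₄ (suc (suc (suc zero))) = refl
  toℕ₄-fromℕ₄ (suc (suc (suc (suc n)))) = toℕ₄-fromℕ₄ n
  fromℕ₄-% : ∀ n → fromℕ₄ (n % 4) ≡ fromℕ₄ n
  fromℕ₄-% zero = refl
  fromℕ₄-% (suc zero) = refl
  fromℕ₄-% (suc (suc zero)) = refl
  fromℕ₄-% (suc (suc (suc zero))) = refl
  fromℕ₄-% (suc (suc (suc (suc n)))) = fromℕ₄-% n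

  module ℤ₂-Residue = ResidueRing 2 toℕ₂ fromℕ₂ fromℕ₂-toℕ₂ toℕ₂-fromℕ₂ fromℕ₂-%

  module ℤ₄-Residue = ResidueRing 4 toℕ₄ fromℕ₄ fromℕ₄-toℕ₄ toℕ₄-fromℕ₄ fromℕ₄-%

  isZero₂-sound : ∀ a → isZero₂ a ≡ true → a ≡ 0₂
  isZero₂-sound 0₂ e = refl
  isZero₂-sound 1₂ ()

  isZero₄-sound : ∀ a → isZero₄ a ≡ true → a ≡ 0₄
  isZero₄-sound 0₄ e = refl
  isZero₄-sound 1₄ ()
  isZero₄-sound 2₄ ()
  isZero₄-sound 3₄ ()

  module C₂ = Cyclic 0₂ 1₂ _+₂_ _*₂_ isZero₂ ℤ₂-Residue.isCommutativeSemiring isZero₂-sound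
  module C₄ = Cyclic 0₄ 1₄ _+₄_ _*₄_ isZero₄ ℤ₄-Residue.isCommutativeSemiring isZero₄-sound

module BinaryPart where

  -- A vector z with
  -- b′ z = 0 lifts to a polynomial Z with b′ Z ≡ 0 mod xᵅ - 1, i.e.
  -- b′ Z = (xᵅ - 1) K = b′ q K; as ℤ₂[x] has no zero divisors and b′ ≠ 0,
  -- Z = q K, so z = q · K.

  open Rings
  open import Data.Nat using (ℕ; zero; suc; _≤_; z≤n; s≤s)
  open import Data.Nat.Properties using (≤-trans; ≤-refl; ≤-pred; _≤?_; ≰⇒>; m≤n⇒m≤1+n; m≤n⇒m⊓n≡m; m⊓n≤m; m∸n≤m)
  open import Data.List using ([]; _∷_; length; take; drop)
  open import Data.List.Properties using (take++drop≡id; length-take; length-drop)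
  open import Data.Product using (∃-syntax; _×_; _,_; proj₁; proj₂)
  open import Data.Sum using (_⊎_; inj₁; inj₂)
  open import Data.Empty using (⊥-elim)
  open import Relation.Nullary using (Dec; yes; no)
  open import Relation.Binary.PropositionalEquality
  open C₂ using (Poly; _+P_; _*P_; Vec; zeroV; _+V_; _≈P_; coeff; X^; e₀; shift; _≐_; ≐-refl; ≐-sym; ≐-trans; +V-cong; iter)
  open ≡-Reasoning

  actS : ∀ {n} → Poly → Vec n → Vec n
  actS = C₂.S.actT

  +₂-self : ∀ a → a +₂ a ≡ 0₂
  +₂-self 0₂ = refl
  +₂-self 1₂ = refl

  +₂-cancel : ∀ a b → a +₂ b ≡ 0₂ → a ≡ b
  +₂-cancel 0₂ 0₂ e = refl
  +₂-cancel 0₂ 1₂ ()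
  +₂-cancel 1₂ 0₂ ()
  +₂-cancel 1₂ 1₂ e = refl

  +₂-regroup : ∀ l h s x → (l +₂ h) +₂ x ≡ (l +₂ s) +₂ ((s +₂ h) +₂ x)
  +₂-regroup l h s x = begin
    (l +₂ h) +₂ x                   ≡⟨ cong (λ y → (y +₂ h) +₂ x) (C₂.⊕-idʳ l) ⟨
    ((l +₂ 0₂) +₂ h) +₂ x           ≡⟨ cong (λ y → ((l +₂ y) +₂ h) +₂ x) (+₂-self s) ⟨
    ((l +₂ (s +₂ s)) +₂ h) +₂ x     ≡⟨ cong (λ y → (y +₂ h) +₂ x) (C₂.⊕-assoc l s s) ⟨
    (((l +₂ s) +₂ s) +₂ h) +₂ x     ≡⟨ cong (_+₂ x) (C₂.⊕-assoc (l +₂ s) s h) ⟩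
    ((l +₂ s) +₂ (s +₂ h)) +₂ x     ≡⟨ C₂.⊕-assoc (l +₂ s) (s +₂ h) x ⟩
    (l +₂ s) +₂ ((s +₂ h) +₂ x)     ∎

  actS-Xn-1 : ∀ {n} α (v : Vec n) → actS (Xn-1₂ α) v ≐ (iter shift α v +V v)
  actS-Xn-1 α v = ≐-trans (C₂.S.actT-+P (X^ α) (1₂ ∷ []) v)
                    (+V-cong (C₂.S.actT-X^ α v) (≐-trans (C₂.S.actT-const 1₂ v) (C₂.scaleV-1 v)))

  actS-Xn-1-annihilates : ∀ {n} (v : Vec n) → actS (Xn-1₂ n) v ≐ zeroV
  actS-Xn-1-annihilates {n} v i =
    trans (actS-Xn-1 n v i) (trans (cong (_+₂ v i) (C₂.shift-order v i)) (+₂-self (v i)))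

  actS-take-drop : ∀ α P {n} (v : Vec n) → α ≤ length P →
                   actS P v ≐ (actS (take α P) v +V iter shift α (actS (drop α P) v))
  actS-take-drop α P v α≤P =
    ≐-trans (λ i → cong (λ Q → actS Q v i) (sym (take++drop≡id α P)))
      (≐-trans (C₂.actS-++ (take α P) (drop α P) v)
        (λ i → cong (λ m → (actS (take α P) v +V iter shift m (actS (drop α P) v)) i) length-low))
    where
    length-low : length (take α P) ≡ α
    length-low = trans (length-take α P) (m≤n⇒m⊓n≡m α≤P)

  fold-high : ∀ α P K {n} (v : Vec n) → α ≤ length P →
              actS ((take α P +P drop α P) +P Xn-1₂ α *P K) v ≐ actS (P +P Xn-1₂ α *P (drop α P +P K)) v
  fold-high α P K v α≤P i = begin
    actS ((low +P high) +P Xn-1₂ α *P K) v i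
      ≡⟨ trans (C₂.S.actT-+P (low +P high) (Xn-1₂ α *P K) v i) (cong (_+₂ actS (Xn-1₂ α *P K) v i) (C₂.S.actT-+P low high v i)) ⟩
    (actS low v i +₂ actS high v i) +₂ actS (Xn-1₂ α *P K) v i
      ≡⟨ +₂-regroup (actS low v i) (actS high v i) (iter shift α (actS high v) i) (actS (Xn-1₂ α *P K) v i) ⟩
    (actS low v i +₂ iter shift α (actS high v) i) +₂ ((iter shift α (actS high v) i +₂ actS high v i) +₂ actS (Xn-1₂ α *P K) v i)
      ≡⟨ cong₂ _+₂_ (sym (actS-take-drop α P v α≤P i))
           (cong₂ _+₂_ (sym (actS-Xn-1 α (actS high v) i)) (C₂.S.actT-*P (Xn-1₂ α) K v i)) ⟩
    actS P v i +₂ (actS (Xn-1₂ α) (actS high v) i +₂ actS (Xn-1₂ α) (actS K v) i)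
      ≡⟨ cong (actS P v i +₂_) (sym (trans (C₂.S.actT-*P (Xn-1₂ α) (high +P K) v i)
           (trans (C₂.S.actT-cong (Xn-1₂ α) (C₂.S.actT-+P high K v) i) (C₂.S.actT-+V (Xn-1₂ α) (actS high v) (actS K v) i)))) ⟩
    actS P v i +₂ actS (Xn-1₂ α *P (high +P K)) v i
      ≡⟨ C₂.S.actT-+P P (Xn-1₂ α *P (high +P K)) v i ⟨
    actS (P +P Xn-1₂ α *P (high +P K)) v i ∎
    where
    low high : Poly
    low = take α P
    high = drop α P

  -- R is a remainder of P modulo xᵅ - 1 (α = a + 1): P + (xᵅ - 1) K = R with deg R < α
  Remainder : ℕ → Poly → Set
  Remainder a P = ∃[ K ] ∃[ R ] (length R ≤ suc a × (∀ {n} (v : Vec n) → actS R v ≐ actS (P +P Xn-1₂ (suc a) *P K) v))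

  -- division with remainder by xᵅ - 1, by repeatedly folding the high part
  -- down; k bounds the length of P and drives the recursion
  mutual
    reduce : ∀ a k P → length P ≤ k → Remainder a P
    reduce a k P P≤k = reduce-by-length a k P P≤k (length P ≤? suc a)

    reduce-by-length : ∀ a k P → length P ≤ k → Dec (length P ≤ suc a) → Remainder a P
    reduce-by-length a k P P≤k (yes P≤α) = [] , P , P≤α , λ v → ≐-sym (begin≐ v)
      where
      begin≐ : ∀ {n} (v : Vec n) → actS (P +P Xn-1₂ (suc a) *P []) v ≐ actS P v
      begin≐ v = ≐-trans (C₂.S.actT-+P P (Xn-1₂ (suc a) *P []) v)
        (≐-trans (+V-cong (≐-refl {u = actS P v}) (≐-trans (C₂.S.actT-*P (Xn-1₂ (suc a)) [] v) (C₂.S.actT-zero (Xn-1₂ (suc a)))))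
                 (C₂.+V-idʳ (actS P v)))
    reduce-by-length a k [] P≤k (no P≰α) = ⊥-elim (P≰α z≤n)
    reduce-by-length a zero (x ∷ P′) () (no P≰α)
    reduce-by-length a (suc k) (x ∷ P′) (s≤s P′≤k) (no P≰α) = fold-down (reduce a k (low +P high) low+high≤k)
      where
      P = x ∷ P′
      α≤P′ : suc a ≤ length P′
      α≤P′ = ≤-pred (≰⇒> P≰α)
      low high : Poly
      low = take (suc a) P
      high = drop (suc a) P
      low+high≤k : length (low +P high) ≤ k
      low+high≤k = C₂.length-+P low high k
        (≤-trans (subst (_≤ suc a) (sym (length-take (suc a) P)) (m⊓n≤m (suc a) _)) (≤-trans α≤P′ P′≤k))
        (≤-trans (subst (_≤ length P′) (sym (length-drop a P′)) (m∸n≤m (length P′) a)) P′≤k)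
      fold-down : Remainder a (low +P high) → Remainder a P
      fold-down (K′ , R′ , R′≤α , R′≡) = (high +P K′) , R′ , R′≤α ,
        λ v → ≐-trans (R′≡ v) (fold-high (suc a) P K′ v (s≤s (≤-trans (m≤n⇒m≤1+n ≤-refl) α≤P′)))

  *P-0∷ˡ : ∀ p q → ((0₂ ∷ p) *P q) ≈P (0₂ ∷ (p *P q))
  *P-0∷ˡ p q = C₂.actS-injective ((0₂ ∷ p) *P q) (0₂ ∷ (p *P q)) λ v →
    ≐-trans (C₂.S.actT-*P (0₂ ∷ p) q v) (≐-trans (C₂.S.actT-0∷ p (actS q v))
      (≐-trans (C₂.shift-cong (≐-sym (C₂.S.actT-*P p q v))) (≐-sym (C₂.S.actT-0∷ (p *P q) v))))

  *P-0∷ʳ : ∀ p q → (p *P (0₂ ∷ q)) ≈P (0₂ ∷ (p *P q))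
  *P-0∷ʳ p q = C₂.actS-injective (p *P (0₂ ∷ q)) (0₂ ∷ (p *P q)) λ v →
    ≐-trans (C₂.S.actT-*P p (0₂ ∷ q) v) (≐-trans (C₂.S.actT-cong p (C₂.S.actT-0∷ q v))
      (≐-trans (C₂.S.actT-T p (actS q v)) (≐-trans (C₂.shift-cong (≐-sym (C₂.S.actT-*P p q v))) (≐-sym (C₂.S.actT-0∷ (p *P q) v)))))

  cancel-const-one : ∀ p q → ((1₂ ∷ p) *P q) ≈P [] → q ≈P []
  cancel-const-one p [] e = λ _ → refl
  cancel-const-one p (0₂ ∷ q) e = λ { zero → refl ; (suc i) → tail≈[] i }
    where
    tail≈[] : q ≈P []
    tail≈[] = cancel-const-one p q (λ i → trans (sym (*P-0∷ʳ (1₂ ∷ p) q (suc i))) (e (suc i)))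
  cancel-const-one p (1₂ ∷ q) e = ⊥-elim (1≢0 (e 0))
    where
    1≢0 : 1₂ ≢ 0₂
    1≢0 ()

  no-zero-divisors : ∀ p q → (p *P q) ≈P [] → p ≈P [] ⊎ q ≈P []
  no-zero-divisors [] q e = inj₁ (λ _ → refl)
  no-zero-divisors (0₂ ∷ p) q e = shift-left (no-zero-divisors p q (λ i → trans (sym (*P-0∷ˡ p q (suc i))) (e (suc i))))
    where
    shift-left : p ≈P [] ⊎ q ≈P [] → (0₂ ∷ p) ≈P [] ⊎ q ≈P []
    shift-left (inj₁ p≈[]) = inj₁ (λ { zero → refl ; (suc i) → p≈[] i })
    shift-left (inj₂ q≈[]) = inj₂ q≈[]
  no-zero-divisors (1₂ ∷ p) q e = inj₂ (cancel-const-one p q e)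

  annihilator⊆ideal : ∀ α (b′ q : Poly) → (b′ *P q) ≈P Xn-1₂ α → (z : Vec α) → actS b′ z ≐ zeroV → ∃[ u ] (z ≐ actS q u)
  annihilator⊆ideal zero b′ q b′q z b′z = z , λ ()
  annihilator⊆ideal (suc a) b′ q b′q z b′z =
    conclude (no-zero-divisors b′ (Z +P q *P K) (C₂.actS-injective (b′ *P (Z +P q *P K)) [] b′[Z+qK]≡0))
    where
    α : ℕ
    α = suc a
    Z : Poly
    Z = C₂.toPoly z
    remainder : Remainder a (b′ *P Z)
    remainder = reduce a (length (b′ *P Z)) (b′ *P Z) ≤-refl
    K R : Poly
    K = proj₁ remainder
    R = proj₁ (proj₂ remainder)
    R≤α : length R ≤ α
    R≤α = proj₁ (proj₂ (proj₂ remainder))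
    R≡P : ∀ {n} (v : Vec n) → actS R v ≐ actS (b′ *P Z +P Xn-1₂ α *P K) v
    R≡P = proj₂ (proj₂ (proj₂ remainder))
    -- the remainder of b′ Z vanishes in ℤ₂[x]/(xᵅ - 1), and is short, so it is 0
    R-vanishes : actS {α} R e₀ ≐ zeroV
    R-vanishes = ≐-trans (R≡P e₀) (≐-trans (C₂.S.actT-+P (b′ *P Z) (Xn-1₂ α *P K) e₀)
      (≐-trans (+V-cong (≐-trans (C₂.S.actT-*P b′ Z e₀) (≐-trans (C₂.S.actT-cong b′ (C₂.embed-toPoly z)) b′z))
                        (≐-trans (C₂.S.actT-*P (Xn-1₂ α) K e₀) (actS-Xn-1-annihilates (actS K e₀))))
               (C₂.+V-idˡ zeroV)))
    R≈[] : R ≈P []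
    R≈[] = C₂.short-embed-injective α R [] R≤α z≤n R-vanishes
    -- b′ (Z + q K) = b′ Z + (xᵅ - 1) K = R = 0
    b′[Z+qK]≡0 : ∀ {n} (v : Vec n) → actS (b′ *P (Z +P q *P K)) v ≐ actS [] v
    b′[Z+qK]≡0 v =
      ≐-trans (C₂.S.actT-*P b′ (Z +P q *P K) v) (≐-trans (C₂.S.actT-cong b′ (C₂.S.actT-+P Z (q *P K) v))
      (≐-trans (C₂.S.actT-+V b′ (actS Z v) (actS (q *P K) v)) (≐-trans (+V-cong (≐-sym (C₂.S.actT-*P b′ Z v)) b′qK)
      (≐-trans (≐-sym (C₂.S.actT-+P (b′ *P Z) (Xn-1₂ α *P K) v)) (≐-trans (≐-sym (R≡P v)) (C₂.S.actT-≈P R [] v R≈[]))))))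
      where
      b′qK : actS b′ (actS (q *P K) v) ≐ actS (Xn-1₂ α *P K) v
      b′qK = ≐-trans (C₂.S.actT-cong b′ (C₂.S.actT-*P q K v)) (≐-trans (≐-sym (C₂.S.actT-*P b′ q _))
               (≐-trans (C₂.S.actT-≈P (b′ *P q) (Xn-1₂ α) _ b′q) (≐-sym (C₂.S.actT-*P (Xn-1₂ α) K v))))
    conclude : b′ ≈P [] ⊎ (Z +P q *P K) ≈P [] → ∃[ u ] (z ≐ actS q u)
    -- b′ ≠ 0, as the constant term of b′ q = xᵅ - 1 is 1
    conclude (inj₁ b′≈[]) = ⊥-elim (1≢0 (trans (sym (b′q 0)) (C₂.actS-injective (b′ *P q) [] b′q≈[] 0)))
      where
      b′q≈[] : ∀ {n} (v : Vec n) → actS (b′ *P q) v ≐ actS [] v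
      b′q≈[] v = ≐-trans (C₂.S.actT-*P b′ q v) (C₂.S.actT-≈P b′ [] (actS q v) b′≈[])
      1≢0 : 1₂ ≢ 0₂
      1≢0 ()
    conclude (inj₂ Z+qK≈[]) = actS K e₀ , λ i → begin
      z i                                    ≡⟨ C₂.embed-toPoly z i ⟨
      actS Z e₀ i                            ≡⟨ +₂-cancel (actS Z e₀ i) (actS (q *P K) e₀ i) (Z+qK≡0 i) ⟩
      actS (q *P K) e₀ i                     ≡⟨ C₂.S.actT-*P q K e₀ i ⟩
      actS q (actS K e₀) i                   ∎
      where
      Z+qK≡0 : ∀ i → actS Z e₀ i +₂ actS (q *P K) e₀ i ≡ 0₂
      Z+qK≡0 i = trans (sym (C₂.S.actT-+P Z (q *P K) e₀ i)) (C₂.S.actT-≈P (Z +P q *P K) [] e₀ Z+qK≈[] i)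

  -- The form in which the theorem uses it: the annihilator of b(x⁻¹) is q · ℤ₂[x]/(xᵅ - 1)
  -- whenever b* q = xᵅ - 1, because b(x⁻¹) = xᵏ b*(x) for some k.
  module ReciprocalAnnihilator (α : ℕ) (b q : Poly) (b*q : (P₂.recip b *P q) ≈P Xn-1₂ α) where

    k : ℕ

    k = proj₁ (C₂.actU-recip {α} b)

    actU-b : ∀ v → C₂.U.actT b v ≐ iter shift k (actS (P₂.recip b) v)
    actU-b = proj₂ (C₂.actU-recip {α} b)

    annihilated⇒ideal : (z : Vec α) → C₂.U.actT b z ≐ zeroV → ∃[ u ] (z ≐ actS q u)
    annihilated⇒ideal z bz = annihilator⊆ideal α (P₂.recip b) q b*q z
      (C₂.iter-shift-injective k (actS (P₂.recip b) z) (≐-trans (≐-sym (actU-b z)) bz))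

    ideal⇒annihilated : (u : Vec α) → C₂.U.actT b (actS q u) ≐ zeroV
    ideal⇒annihilated u = ≐-trans (actU-b (actS q u)) (≐-trans (C₂.S.iterT-cong k b*q·u≡0) (C₂.S.iterT-zero k))
      where
      b*q·u≡0 : actS (P₂.recip b) (actS q u) ≐ zeroV
      b*q·u≡0 = ≐-trans (≐-sym (C₂.S.actT-*P (P₂.recip b) q u))
                  (≐-trans (C₂.S.actT-≈P (P₂.recip b *P q) (Xn-1₂ α) u b*q) (actS-Xn-1-annihilates u))

module QuaternaryAnnihilator where

  open Rings
  open import Data.Nat using (ℕ; zero; suc)
  open import Data.List using ([]; _∷_)
  open import Data.Product using (∃-syntax; _,_)
  open import Relation.Binary.PropositionalEquality
  open P₄ using (Poly; _+P_; _*P_; Vec; zeroV; _+V_; scaleV)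
  open C₄ using (_≐_; ≐-refl; ≐-sym; ≐-trans; +V-cong)

  half : ℤ₄ → ℤ₄
  half 2₄ = 1₄
  half _ = 0₄

  2a≡0⇒a≡2·half : ∀ a → 2₄ *₄ a ≡ 0₄ → a ≡ 2₄ *₄ half a
  2a≡0⇒a≡2·half 0₄ e = refl
  2a≡0⇒a≡2·half 1₄ ()
  2a≡0⇒a≡2·half 2₄ e = refl
  2a≡0⇒a≡2·half 3₄ ()

  -- The key ring-theoretic step, for any commutative ring of operators
  -- p ↦ p(T) on a ℤ₄-module: if f g h = 0 with f, g, h pairwise coprime and
  -- v is a unit, then every z with f (h + 2) z = 0 lies in the image of
  -- g (h + 2v).  (In the paper this is the statement that the annihilator
  -- of ⟨fh + 2f⟩ is ⟨gh + 2g⟩, up to the unit v.)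
  module Annihilator {n : ℕ} (T : Vec n → Vec n)
      (T-cong : ∀ {u v} → u ≐ v → T u ≐ T v)
      (T-+ : ∀ u v → T (u +V v) ≐ (T u +V T v))
      (T-scale : ∀ a u → T (scaleV a u) ≐ scaleV a (T u))
      (f g h a₁ b₁ a₂ b₂ a₃ b₃ v v′ : Poly) where

    open C₄.LinearOperator T T-cong T-+ T-scale
    open import Tactic.RingSolver.NonReflective operatorRing using (solve; _⊜_; _⊕_; _⊗_)

    one two : Poly
    one = 1₄ ∷ []
    two = 2₄ ∷ []

    one*ˡ : ∀ X → (one *P X) ~ X
    one*ˡ X = mk~ λ w → ≐-trans (actT-*P one X w) (actT-one _)

    subst-*+ : ∀ {X X′} K R → X ~ X′ → (X *P K +P R) ~ (X′ *P K +P R)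
    subst-*+ {X} {X′} K R e = +P-cong~ {X *P K} {X′ *P K} {R} {R} (*P-cong~ {X} {X′} {K} {K} e (~-refl {K})) (~-refl {R})

    subst-+ : ∀ {X X′} R → X ~ X′ → (X +P R) ~ (X′ +P R)
    subst-+ {X} {X′} R e = +P-cong~ {X} {X′} {R} {R} e (~-refl {R})

    2+2≈0 : (two +P two) ~ []
    2+2≈0 = mk~ λ w → actT-≈0 (0₄ ∷ []) w (λ { zero → refl ; (suc i) → refl })

    2·2≈0 : (two *P two) ~ []
    2·2≈0 = mk~ λ w → actT-≈0 (0₄ ∷ []) w (λ { zero → refl ; (suc i) → refl })

    -- G₀ = g (h + 2v) generates the image; A, B, C come from the Bézout
    -- identities and E = 1 + 2B, Q are auxiliary cofactors
    G₀ A B C E Q : Poly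
    G₀ = g *P (h +P two *P v)
    A = a₂ *P a₃
    B = a₂ *P f *P b₃ +P b₂ *P a₃ *P g +P b₂ *P b₃ *P h
    C = a₁ *P a₂ *P f +P a₁ *P b₂ *P h +P b₁ *P a₂ *P g
    E = one +P two *P B
    Q = one +P v *P (a₂ *P f *P v′ +P two *P b₂)

    module _ (fgh≈0 : (f *P g *P h) ~ [])
             (bezout-fg : (a₁ *P f +P b₁ *P g) ~ one)
             (bezout-fh : (a₂ *P f +P b₂ *P h) ~ one)
             (bezout-gh : (a₃ *P g +P b₃ *P h) ~ one)
             (vv′≈1 : (v *P v′) ~ one) where

      -- 1 = (a₁f + b₁g)(a₂f + b₂h) = C f + b₁b₂ · gh
      one≈Cf+b₁b₂gh : one ~ (C *P f +P b₁ *P b₂ *P (g *P h))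
      one≈Cf+b₁b₂gh = ~-trans (~-sym (one*ˡ one)) (~-trans (*P-cong~ (~-sym bezout-fg) (~-sym bezout-fh)) (expand a₁ b₁ a₂ b₂ f g h))
        where
        expand : ∀ a₁ b₁ a₂ b₂ f g h → ((a₁ *P f +P b₁ *P g) *P (a₂ *P f +P b₂ *P h)) ~
                   ((a₁ *P a₂ *P f +P a₁ *P b₂ *P h +P b₁ *P a₂ *P g) *P f +P b₁ *P b₂ *P (g *P h))
        expand = solve 7 (λ a₁ b₁ a₂ b₂ f g h → ((a₁ ⊗ f ⊕ b₁ ⊗ g) ⊗ (a₂ ⊗ f ⊕ b₂ ⊗ h)) ⊜
                   ((a₁ ⊗ a₂ ⊗ f ⊕ a₁ ⊗ b₂ ⊗ h ⊕ b₁ ⊗ a₂ ⊗ g) ⊗ f ⊕ b₁ ⊗ b₂ ⊗ (g ⊗ h))) (mk~ λ w i → refl)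

      -- 1 = (a₂f + b₂h)(a₃g + b₃h) = A · fg + B h
      one≈Afg+Bh : one ~ (A *P (f *P g) +P B *P h)
      one≈Afg+Bh = ~-trans (~-sym (one*ˡ one)) (~-trans (*P-cong~ (~-sym bezout-fh) (~-sym bezout-gh)) (expand a₂ b₂ a₃ b₃ f g h))
        where
        expand : ∀ a₂ b₂ a₃ b₃ f g h → ((a₂ *P f +P b₂ *P h) *P (a₃ *P g +P b₃ *P h)) ~
                   (a₂ *P a₃ *P (f *P g) +P (a₂ *P f *P b₃ +P b₂ *P a₃ *P g +P b₂ *P b₃ *P h) *P h)
        expand = solve 7 (λ a₂ b₂ a₃ b₃ f g h → ((a₂ ⊗ f ⊕ b₂ ⊗ h) ⊗ (a₃ ⊗ g ⊕ b₃ ⊗ h)) ⊜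
                   (a₂ ⊗ a₃ ⊗ (f ⊗ g) ⊕ (a₂ ⊗ f ⊗ b₃ ⊕ b₂ ⊗ a₃ ⊗ g ⊕ b₂ ⊗ b₃ ⊗ h) ⊗ h)) (mk~ λ w i → refl)

      -- E = 1 + 2B is an involution: E² = 1 + 4B + 4B² = 1
      E²≈1 : (E *P E) ~ one
      E²≈1 = ~-trans (expand one two B)
               (~-trans (subst-*+ (one *P B) ((two *P two) *P (B *P B) +P one *P one) 2+2≈0)
               (~-trans (subst-*+ (B *P B) (one *P one) 2·2≈0) (one*ˡ one)))
        where
        expand : ∀ o t B → ((o +P t *P B) *P (o +P t *P B)) ~ ((t +P t) *P (o *P B) +P ((t *P t) *P (B *P B) +P o *P o))
        expand = solve 3 (λ o t B → ((o ⊕ t ⊗ B) ⊗ (o ⊕ t ⊗ B)) ⊜ ((t ⊕ t) ⊗ (o ⊗ B) ⊕ ((t ⊗ t) ⊗ (B ⊗ B) ⊕ o ⊗ o)))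
                   (mk~ λ w i → refl)

      -- B (h + 2) + A fg = (A fg + B h) + 2B = E
      B[h+2]+Afg≈E : (B *P (h +P two) +P A *P (f *P g)) ~ E
      B[h+2]+Afg≈E = ~-trans (regroup two A B f g h) (subst-+ (two *P B) (~-sym one≈Afg+Bh))
        where
        regroup : ∀ t A B f g h → (B *P (h +P t) +P A *P (f *P g)) ~ ((A *P (f *P g) +P B *P h) +P t *P B)
        regroup = solve 6 (λ t A B f g h → (B ⊗ (h ⊕ t) ⊕ A ⊗ (f ⊗ g)) ⊜ ((A ⊗ (f ⊗ g) ⊕ B ⊗ h) ⊕ t ⊗ B)) (mk~ λ w i → refl)

      -- gh = G₀ Q: modulo fgh = 0, 4 = 0 and vv′ = 1, the product G₀ Q expands to
      -- gh + 2vg (a₂f + b₂h) + 2vg = gh + 4vg = gh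
      gh≈G₀Q : (g *P h) ~ (G₀ *P Q)
      gh≈G₀Q = ~-sym (~-trans (expand one two g h v v′ a₂ b₂ f)
                 (~-trans (subst-*+ (v *P a₂ *P v′) _ fgh≈0)
                 (~-trans (subst-*+ (v *P v *P g *P b₂) _ 2·2≈0)
                 (~-trans (subst-*+ (two *P v *P a₂ *P f *P g) _ vv′≈1)
                 (~-trans (subst-+ _ (one*ˡ (two *P v *P a₂ *P f *P g)))
                 (~-trans (collect one two g h v a₂ b₂ f)
                 (~-trans (subst-*+ (two *P v *P g) _ bezout-fh)
                 (~-trans (double one two g h v)
                 (~-trans (subst-*+ (v *P g *P one) _ 2+2≈0) (one*ˡ (g *P h)))))))))))
        where
        expand : ∀ o t g h v v′ a₂ b₂ f → ((g *P (h +P t *P v)) *P (o +P v *P (a₂ *P f *P v′ +P t *P b₂))) ~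
                   ((f *P g *P h) *P (v *P a₂ *P v′) +P ((t *P t) *P (v *P v *P g *P b₂) +P ((v *P v′) *P (t *P v *P a₂ *P f *P g)
                      +P (g *P h *P o +P t *P v *P g *P o +P t *P v *P b₂ *P g *P h))))
        expand = solve 9 (λ o t g h v v′ a₂ b₂ f → ((g ⊗ (h ⊕ t ⊗ v)) ⊗ (o ⊕ v ⊗ (a₂ ⊗ f ⊗ v′ ⊕ t ⊗ b₂))) ⊜
                   ((f ⊗ g ⊗ h) ⊗ (v ⊗ a₂ ⊗ v′) ⊕ ((t ⊗ t) ⊗ (v ⊗ v ⊗ g ⊗ b₂) ⊕ ((v ⊗ v′) ⊗ (t ⊗ v ⊗ a₂ ⊗ f ⊗ g)
                      ⊕ (g ⊗ h ⊗ o ⊕ t ⊗ v ⊗ g ⊗ o ⊕ t ⊗ v ⊗ b₂ ⊗ g ⊗ h))))) (mk~ λ w i → refl)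
        collect : ∀ o t g h v a₂ b₂ f → (t *P v *P a₂ *P f *P g +P (g *P h *P o +P t *P v *P g *P o +P t *P v *P b₂ *P g *P h)) ~
                    ((a₂ *P f +P b₂ *P h) *P (t *P v *P g) +P (g *P h *P o +P t *P v *P g *P o))
        collect = solve 8 (λ o t g h v a₂ b₂ f → (t ⊗ v ⊗ a₂ ⊗ f ⊗ g ⊕ (g ⊗ h ⊗ o ⊕ t ⊗ v ⊗ g ⊗ o ⊕ t ⊗ v ⊗ b₂ ⊗ g ⊗ h)) ⊜
                    ((a₂ ⊗ f ⊕ b₂ ⊗ h) ⊗ (t ⊗ v ⊗ g) ⊕ (g ⊗ h ⊗ o ⊕ t ⊗ v ⊗ g ⊗ o))) (mk~ λ w i → refl)
        double : ∀ o t g h v → (o *P (t *P v *P g) +P (g *P h *P o +P t *P v *P g *P o)) ~ ((t +P t) *P (v *P g *P o) +P o *P (g *P h))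
        double = solve 5 (λ o t g h v → (o ⊗ (t ⊗ v ⊗ g) ⊕ (g ⊗ h ⊗ o ⊕ t ⊗ v ⊗ g ⊗ o)) ⊜ ((t ⊕ t) ⊗ (v ⊗ g ⊗ o) ⊕ o ⊗ (g ⊗ h)))
                   (mk~ λ w i → refl)

      -- 2fg = G₀ · f v′, since G₀ f v′ = fgh v′ + 2 fg vv′
      2fg≈G₀fv′ : (two *P (f *P g)) ~ (G₀ *P (f *P v′))
      2fg≈G₀fv′ = ~-sym (~-trans (expand two g h v v′ f) (~-trans (subst-*+ v′ _ fgh≈0)
                    (~-trans (*P-cong~ vv′≈1 (~-refl {two *P (f *P g)})) (one*ˡ _))))
        where
        expand : ∀ t g h v v′ f → ((g *P (h +P t *P v)) *P (f *P v′)) ~ ((f *P g *P h) *P v′ +P (v *P v′) *P (t *P (f *P g)))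
        expand = solve 6 (λ t g h v v′ f → ((g ⊗ (h ⊕ t ⊗ v)) ⊗ (f ⊗ v′)) ⊜ ((f ⊗ g ⊗ h) ⊗ v′ ⊕ (v ⊗ v′) ⊗ (t ⊗ (f ⊗ g))))
                   (mk~ λ w i → refl)

      annihilated⇒image : ∀ z → actT (f *P (h +P two)) z ≐ zeroV → ∃[ t ] (z ≐ actT G₀ t)
      annihilated⇒image z fz≐0 = (actT (Q *P K) m +V actT E (actT A (actT (A *P (f *P v′)) y½))) , z≐G₀t
        where
        -- m = (h + 2) z is killed by f, so m = (C f + b₁b₂ gh) m = b₁b₂ gh m
        m : Vec n
        m = actT (h +P two) z
        fm≐0 : actT f m ≐ zeroV
        fm≐0 = ≐-trans (≐-sym (actT-*P f (h +P two) z)) fz≐0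
        m≐b₁b₂ghm : m ≐ actT (b₁ *P b₂ *P (g *P h)) m
        m≐b₁b₂ghm = ≐-trans (≐-sym (actT-one m)) (≐-trans (run~ one≈Cf+b₁b₂gh m) (≐-trans (actT-+P (C *P f) _ m)
                      (≐-trans (+V-cong (≐-trans (actT-*P C f m) (≐-trans (actT-cong C fm≐0) (actT-zero C))) ≐-refl) (C₄.+V-idˡ _))))
        -- y = fg z is killed by h (as fgh = 0) and by h + 2 (as f(h+2) z = 0), hence by 2
        y : Vec n
        y = actT (f *P g) z
        hy≐0 : actT h y ≐ zeroV
        hy≐0 = ≐-trans (≐-sym (actT-*P h (f *P g) z)) (≐-trans (run~ (reorder f g h) z) (run~ fgh≈0 z))
          where
          reorder : ∀ f g h → (h *P (f *P g)) ~ (f *P g *P h)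
          reorder = solve 3 (λ f g h → (h ⊗ (f ⊗ g)) ⊜ (f ⊗ g ⊗ h)) (mk~ λ w i → refl)
        [h+2]y≐0 : actT (h +P two) y ≐ zeroV
        [h+2]y≐0 = ≐-trans (≐-sym (actT-*P (h +P two) (f *P g) z)) (≐-trans (run~ (reorder two f g h) z)
                     (≐-trans (actT-*P g _ z) (≐-trans (actT-cong g fz≐0) (actT-zero g))))
          where
          reorder : ∀ t f g h → ((h +P t) *P (f *P g)) ~ (g *P (f *P (h +P t)))
          reorder = solve 4 (λ t f g h → ((h ⊕ t) ⊗ (f ⊗ g)) ⊜ (g ⊗ (f ⊗ (h ⊕ t)))) (mk~ λ w i → refl)
        2y≐0 : actT two y ≐ zeroV
        2y≐0 = ≐-trans (≐-sym (C₄.+V-idˡ _)) (≐-trans (+V-cong (≐-sym hy≐0) ≐-refl) (≐-trans (≐-sym (actT-+P h two y)) [h+2]y≐0))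
        -- so y = 2 y½ …
        y½ : Vec n
        y½ i = half (y i)
        y≐2y½ : y ≐ actT two y½
        y≐2y½ i = trans (2a≡0⇒a≡2·half (y i) (trans (sym (actT-const 2₄ y i)) (2y≐0 i))) (sym (actT-const 2₄ y½ i))
        -- … and y = (A fg + B h) y = A fg y = A · 2fg y½ = G₀ (A f v′ y½)
        y≐G₀… : y ≐ actT G₀ (actT (A *P (f *P v′)) y½)
        y≐G₀… = ≐-trans (≐-sym (actT-one y)) (≐-trans (run~ one≈Afg+Bh y) (≐-trans (actT-+P (A *P (f *P g)) (B *P h) y)
                (≐-trans (+V-cong (≐-refl {u = actT (A *P (f *P g)) y}) (≐-trans (actT-*P B h y) (≐-trans (actT-cong B hy≐0) (actT-zero B))))
                (≐-trans (C₄.+V-idʳ _)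
                (≐-trans (actT-cong (A *P (f *P g)) y≐2y½) (≐-trans (≐-sym (actT-*P (A *P (f *P g)) two y½))
                (≐-trans (run~ (reorder₁ A two f g) y½) (≐-trans (run~ (*P-cong~ (~-refl {A}) 2fg≈G₀fv′) y½)
                (≐-trans (run~ (reorder₂ A G₀ (f *P v′)) y½) (actT-*P G₀ _ y½))))))))))
          where
          reorder₁ : ∀ A t f g → ((A *P (f *P g)) *P t) ~ (A *P (t *P (f *P g)))
          reorder₁ = solve 4 (λ A t f g → ((A ⊗ (f ⊗ g)) ⊗ t) ⊜ (A ⊗ (t ⊗ (f ⊗ g)))) (mk~ λ w i → refl)
          reorder₂ : ∀ A G K → (A *P (G *P K)) ~ (G *P (A *P K))
          reorder₂ = solve 3 (λ A G K → (A ⊗ (G ⊗ K)) ⊜ (G ⊗ (A ⊗ K))) (mk~ λ w i → refl)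
        -- E z = B (h + 2) z + A fg z = B m + A y
        Ez≐Bm+Ay : actT E z ≐ (actT B m +V actT A y)
        Ez≐Bm+Ay = ≐-trans (≐-sym (run~ B[h+2]+Afg≈E z)) (≐-trans (actT-+P (B *P (h +P two)) (A *P (f *P g)) z)
                     (+V-cong (actT-*P B _ z) (actT-*P A _ z)))
        K : Poly
        K = E *P B *P b₁ *P b₂
        EBm≐G₀… : actT E (actT B m) ≐ actT G₀ (actT (Q *P K) m)
        EBm≐G₀… = ≐-trans (≐-sym (actT-*P E B m)) (≐-trans (actT-cong (E *P B) m≐b₁b₂ghm) (≐-trans (≐-sym (actT-*P (E *P B) _ m))
                   (≐-trans (run~ (reorder₁ E B b₁ b₂ g h) m) (≐-trans (run~ (*P-cong~ gh≈G₀Q (~-refl {K})) m)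
                   (≐-trans (run~ (reorder₂ G₀ Q K) m) (actT-*P G₀ (Q *P K) m))))))
          where
          reorder₁ : ∀ E B b₁ b₂ g h → ((E *P B) *P (b₁ *P b₂ *P (g *P h))) ~ ((g *P h) *P (E *P B *P b₁ *P b₂))
          reorder₁ = solve 6 (λ E B b₁ b₂ g h → ((E ⊗ B) ⊗ (b₁ ⊗ b₂ ⊗ (g ⊗ h))) ⊜ ((g ⊗ h) ⊗ (E ⊗ B ⊗ b₁ ⊗ b₂))) (mk~ λ w i → refl)
          reorder₂ : ∀ G Q K → ((G *P Q) *P K) ~ (G *P (Q *P K))
          reorder₂ = solve 3 (λ G Q K → ((G ⊗ Q) ⊗ K) ⊜ (G ⊗ (Q ⊗ K))) (mk~ λ w i → refl)
        EAy≐G₀… : actT E (actT A y) ≐ actT G₀ (actT E (actT A (actT (A *P (f *P v′)) y½)))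
        EAy≐G₀… = ≐-trans (actT-cong E (actT-cong A y≐G₀…)) (≐-trans (actT-cong E (actT-comm A G₀ _)) (actT-comm E G₀ _))
        -- z = E² z = E (B m + A y)
        z≐G₀t : z ≐ actT G₀ (actT (Q *P K) m +V actT E (actT A (actT (A *P (f *P v′)) y½)))
        z≐G₀t = ≐-trans (≐-sym (actT-one z)) (≐-trans (run~ (~-sym E²≈1) z) (≐-trans (actT-*P E E z)
                (≐-trans (actT-cong E Ez≐Bm+Ay) (≐-trans (actT-+V E _ _) (≐-trans (+V-cong EBm≐G₀… EAy≐G₀…) (≐-sym (actT-+V G₀ _ _)))))))

module QuaternaryPart where

  -- Through x⁻¹ ↦ reciprocal, F(x⁻¹) corresponds to
  -- xᵏ F*, and F* G is a multiple of f*g*h* plus a multiple of 4, hence 0;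
  -- conversely the annihilator step applies in the ring of operators p(x⁻¹).

  open Rings
  open import Data.Nat using (ℕ; zero; suc; _+_; _*_)
  open import Data.Nat.Properties using (*-suc; +-comm)
  open import Data.List using ([]; _∷_)
  open import Data.Product using (∃-syntax; _,_; proj₁; proj₂)
  open import Relation.Binary.PropositionalEquality
  open P₄ using (Poly; _*P_; _+P_; X^; recip; _≈P_; _+V_)
  open C₄ using (_≐_; ≐-refl; ≐-sym; ≐-trans; +V-cong; iter)

  two : Poly
  two = 2₄ ∷ []

  a+3a≡0 : ∀ a → a +₄ (3₄ *₄ a) ≡ 0₄
  a+3a≡0 0₄ = refl
  a+3a≡0 1₄ = refl
  a+3a≡0 2₄ = refl
  a+3a≡0 3₄ = refl

  actU≐actS-recip : ∀ {n} p → ∃[ k ] (∀ (w : P₄.Vec n) → C₄.U.actT p w ≐ C₄.S.actT (X^ k *P recip p) w)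
  actU≐actS-recip {n} p = k , λ w → ≐-trans (proj₂ (C₄.actU-recip p) w) (≐-trans (≐-sym (C₄.S.actT-X^ k _)) (≐-sym (C₄.S.actT-*P (X^ k) (recip p) w)))
    where
    k = proj₁ (C₄.actU-recip {n} p)

  module Quaternary {m : ℕ} (f g h a₁ b₁ a₂ b₂ a₃ b₃ : Poly)
    (fgh≈xⁿ-1 : (f *P g *P h) ≈P Xn-1₄ (suc m))
    (bezout-fg : (a₁ *P f +P b₁ *P g) ≈P (1₄ ∷ []))
    (bezout-fh : (a₂ *P f +P b₂ *P h) ≈P (1₄ ∷ []))
    (bezout-gh : (a₃ *P g +P b₃ *P h) ≈P (1₄ ∷ [])) where

    n : ℕ

    n = suc m
    open import Relation.Binary.Reasoning.Setoid (C₄.≐-setoid n)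

    module S where
      open C₄.S {n} public
      open import Tactic.RingSolver.NonReflective operatorRing public using (solve; _⊜_; _⊕_; _⊗_)

    module U where
      open C₄.U {n} public
      open import Tactic.RingSolver.NonReflective operatorRing public using (solve; _⊜_; _⊕_; _⊗_)

    F G : Poly
    F = f *P h +P two *P f
    G = recip g *P recip h +P two *P recip g

    fgh≈0 : (f *P g *P h) U.~ []
    fgh≈0 = U.mk~ λ w → ≐-trans (U.actT-≈P (f *P g *P h) (Xn-1₄ n) w fgh≈xⁿ-1) (xⁿ-1≐0 w)
      where
      xⁿ-1≐0 : ∀ (w : P₄.Vec n) → U.actT (Xn-1₄ n) w ≐ P₄.zeroV
      xⁿ-1≐0 w i = trans (U.actT-+P (X^ n) (3₄ ∷ []) w i)
        (trans (cong₂ _+₄_ (trans (U.actT-X^ n w i) (C₄.unshift-order w i)) (U.actT-const 3₄ w i)) (a+3a≡0 (w i)))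

    kf kg kh : ℕ

    kf = proj₁ (actU≐actS-recip {n} f)
    kg = proj₁ (actU≐actS-recip {n} g)
    kh = proj₁ (actU≐actS-recip {n} h)
    f̂ ĝ ĥ : Poly
    f̂ = X^ kf *P recip f
    ĝ = X^ kg *P recip g
    ĥ = X^ kh *P recip h

    f-recip : ∀ (w : P₄.Vec n) → U.actT f w ≐ S.actT f̂ w
    f-recip = proj₂ (actU≐actS-recip {n} f)
    g-recip : ∀ (w : P₄.Vec n) → U.actT g w ≐ S.actT ĝ w
    g-recip = proj₂ (actU≐actS-recip {n} g)
    h-recip : ∀ (w : P₄.Vec n) → U.actT h w ≐ S.actT ĥ w
    h-recip = proj₂ (actU≐actS-recip {n} h)

    -- f* g* h* acts as zero: xᵏ f*g*h* = f̂ ĝ ĥ acts as (fgh)(x⁻¹) = 0 and x is invertible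
    f*g*h*≈0 : (recip f *P recip g *P recip h) S.~ []
    f*g*h*≈0 = S.mk~ λ w →
      C₄.iter-shift-injective kh _ (C₄.iter-shift-injective kg _ (C₄.iter-shift-injective kf _ (shifted≐0 w)))
      where
      shifted≐0 : ∀ w → iter P₄.shift kf (iter P₄.shift kg (iter P₄.shift kh (S.actT (recip f *P recip g *P recip h) w))) ≐ P₄.zeroV
      shifted≐0 w = begin
        iter P₄.shift kf (iter P₄.shift kg (iter P₄.shift kh y))
          ≈⟨ ≐-sym (≐-trans (S.actT-X^ kf _) (S.iterT-cong kf (≐-trans (S.actT-X^ kg _) (S.iterT-cong kg (S.actT-X^ kh y))))) ⟩
        S.actT (X^ kf) (S.actT (X^ kg) (S.actT (X^ kh) y))
          ≈⟨ ≐-sym (≐-trans (S.actT-*P (X^ kf) (X^ kg *P X^ kh) y) (S.actT-cong (X^ kf) (S.actT-*P (X^ kg) (X^ kh) y))) ⟩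
        S.actT (X^ kf *P (X^ kg *P X^ kh)) y
          ≈⟨ ≐-sym (S.actT-*P (X^ kf *P (X^ kg *P X^ kh)) (recip f *P recip g *P recip h) w) ⟩
        S.actT ((X^ kf *P (X^ kg *P X^ kh)) *P (recip f *P recip g *P recip h)) w
          ≈⟨ ≐-sym (S.run~ (regroup (X^ kf) (X^ kg) (X^ kh) (recip f) (recip g) (recip h)) w) ⟩
        S.actT (f̂ *P (ĝ *P ĥ)) w
          ≈⟨ ≐-trans (S.actT-*P f̂ (ĝ *P ĥ) w) (S.actT-cong f̂ (S.actT-*P ĝ ĥ w)) ⟩
        S.actT f̂ (S.actT ĝ (S.actT ĥ w))
          ≈⟨ ≐-sym (≐-trans (f-recip _) (S.actT-cong f̂ (≐-trans (g-recip _) (S.actT-cong ĝ (h-recip w))))) ⟩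
        U.actT f (U.actT g (U.actT h w))
          ≈⟨ ≐-sym (≐-trans (U.actT-*P (f *P g) h w) (U.actT-*P f g (U.actT h w))) ⟩
        U.actT (f *P g *P h) w
          ≈⟨ U.run~ fgh≈0 w ⟩
        P₄.zeroV ∎
        where
        y : P₄.Vec n
        y = S.actT (recip f *P recip g *P recip h) w
        regroup : ∀ Xf Xg Xh f g h → ((Xf *P f) *P ((Xg *P g) *P (Xh *P h))) S.~ ((Xf *P (Xg *P Xh)) *P (f *P g *P h))
        regroup = S.solve 6 (λ Xf Xg Xh f g h → ((Xf S.⊗ f) S.⊗ ((Xg S.⊗ g) S.⊗ (Xh S.⊗ h))) S.⊜ ((Xf S.⊗ (Xg S.⊗ Xh)) S.⊗ (f S.⊗ g S.⊗ h)))
                    (S.mk~ λ v i → refl)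

    F-recip : ∀ x → U.actT F x ≐ S.actT (f̂ *P ĥ +P two *P f̂) x
    F-recip x = begin
      U.actT F x                                          ≈⟨ U.actT-+P (f *P h) (two *P f) x ⟩
      U.actT (f *P h) x +V U.actT (two *P f) x            ≈⟨ +V-cong (U.actT-*P f h x) (U.actT-*P two f x) ⟩
      U.actT f (U.actT h x) +V U.actT two (U.actT f x)
        ≈⟨ +V-cong (≐-trans (f-recip (U.actT h x)) (S.actT-cong f̂ (h-recip x)))
                   (≐-trans (U.actT-const 2₄ (U.actT f x)) (≐-trans (C₄.scaleV-cong 2₄ (f-recip x)) (≐-sym (S.actT-const 2₄ (S.actT f̂ x))))) ⟩
      S.actT f̂ (S.actT ĥ x) +V S.actT two (S.actT f̂ x)   ≈⟨ ≐-sym (+V-cong (S.actT-*P f̂ ĥ x) (S.actT-*P two f̂ x)) ⟩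
      S.actT (f̂ *P ĥ) x +V S.actT (two *P f̂) x           ≈⟨ ≐-sym (S.actT-+P (f̂ *P ĥ) (two *P f̂) x) ⟩
      S.actT (f̂ *P ĥ +P two *P f̂) x                     ∎

    -- G-multiples are killed by F(x⁻¹): (f̂ ĥ + 2 f̂) G = f*g*h* (…) + 4 (…) = 0
    image⇒annihilated : ∀ c → U.actT F (S.actT G c) ≐ P₄.zeroV
    image⇒annihilated c = begin
      U.actT F (S.actT G c)                                 ≈⟨ F-recip (S.actT G c) ⟩
      S.actT (f̂ *P ĥ +P two *P f̂) (S.actT G c)             ≈⟨ ≐-sym (S.actT-*P (f̂ *P ĥ +P two *P f̂) G c) ⟩
      S.actT ((f̂ *P ĥ +P two *P f̂) *P G) c
        ≈⟨ S.run~ (expand (X^ kf) (X^ kh) (recip f) (recip g) (recip h) two) c ⟩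
      S.actT ((recip f *P recip g *P recip h) *P K₁ +P (two *P two) *P K₂) c
        ≈⟨ S.run~ (S.+P-cong~ (S.*P-cong~ f*g*h*≈0 (S.~-refl {K₁})) (S.~-refl {(two *P two) *P K₂})) c ⟩
      S.actT ((two *P two) *P K₂) c
        ≈⟨ S.actT-*P (two *P two) K₂ c ⟩
      S.actT (two *P two) (S.actT K₂ c)
        ≈⟨ S.actT-≈0 (two *P two) (S.actT K₂ c) (λ { zero → refl ; (suc i) → refl }) ⟩
      P₄.zeroV ∎
      where
      K₁ K₂ : Poly
      K₁ = X^ kf *P X^ kh *P recip h +P two *P X^ kf *P X^ kh +P two *P X^ kf
      K₂ = X^ kf *P recip f *P recip g
      open S using (_⊕_; _⊗_; _⊜_)
      expand : ∀ Xf Xh f g h t → (((Xf *P f) *P (Xh *P h) +P t *P (Xf *P f)) *P (g *P h +P t *P g)) S.~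
                 ((f *P g *P h) *P (Xf *P Xh *P h +P t *P Xf *P Xh +P t *P Xf) +P (t *P t) *P (Xf *P f *P g))
      expand = S.solve 6 (λ Xf Xh f g h t → (((Xf ⊗ f) ⊗ (Xh ⊗ h) ⊕ t ⊗ (Xf ⊗ f)) ⊗ (g ⊗ h ⊕ t ⊗ g)) ⊜
                 ((f ⊗ g ⊗ h) ⊗ (Xf ⊗ Xh ⊗ h ⊕ t ⊗ Xf ⊗ Xh ⊕ t ⊗ Xf) ⊕ (t ⊗ t) ⊗ (Xf ⊗ f ⊗ g))) (S.mk~ λ v i → refl)

    -- v = x^(-kh) is a unit in the ring of operators p(x⁻¹): v · x^kh = 1
    v v′ : Poly
    v = X^ (kh * m)
    v′ = X^ kh

    actU-v : ∀ t → U.actT v t ≐ S.actT v′ t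
    actU-v t = ≐-trans (U.actT-X^ (kh * m) t) (≐-trans (C₄.iter-unshift-as-shift kh t) (≐-sym (S.actT-X^ kh t)))

    vv′≈1 : (v *P v′) U.~ (1₄ ∷ [])
    vv′≈1 = U.mk~ λ w → begin
      U.actT (v *P v′) w                           ≈⟨ U.actT-*P v v′ w ⟩
      U.actT v (U.actT v′ w)                       ≈⟨ U.actT-cong v (U.actT-X^ kh w) ⟩
      U.actT v (iter C₄.unshift kh w)              ≈⟨ U.actT-X^ (kh * m) _ ⟩
      iter C₄.unshift (kh * m) (iter C₄.unshift kh w) ≈⟨ (λ i → cong (λ x → x i) (sym (C₄.iter-+ C₄.unshift (kh * m) kh w))) ⟩
      iter C₄.unshift (kh * m + kh) w              ≈⟨ (λ i → cong (λ k → iter C₄.unshift k w i) (trans (+-comm (kh * m) kh) (sym (*-suc kh m)))) ⟩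
      iter C₄.unshift (kh * n) w                   ≈⟨ U.iterT-order-* C₄.unshift-order kh w ⟩
      w                                            ≈⟨ ≐-sym (U.actT-one w) ⟩
      U.actT (1₄ ∷ []) w                           ∎

    module Ann = QuaternaryAnnihilator.Annihilator {n} C₄.unshift C₄.unshift-cong C₄.unshift-+ C₄.unshift-scale f g h a₁ b₁ a₂ b₂ a₃ b₃ v v′

    G₀-recip : ∀ t → U.actT Ann.G₀ t ≐ S.actT G (S.actT (X^ kg *P X^ kh) t)
    G₀-recip t = begin
      U.actT (g *P (h +P two *P v)) t
        ≈⟨ ≐-trans (U.actT-*P g (h +P two *P v) t) (U.actT-cong g (U.actT-+P h (two *P v) t)) ⟩
      U.actT g (U.actT h t +V U.actT (two *P v) t)
        ≈⟨ U.actT-cong g (+V-cong (≐-refl {u = U.actT h t})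
             (≐-trans (U.actT-*P two v t) (≐-trans (U.actT-const 2₄ (U.actT v t)) (C₄.scaleV-cong 2₄ (actU-v t))))) ⟩
      U.actT g (U.actT h t +V P₄.scaleV 2₄ (S.actT v′ t))
        ≈⟨ ≐-trans (g-recip _) (S.actT-cong ĝ (+V-cong (h-recip t) (≐-sym (S.actT-const 2₄ (S.actT v′ t))))) ⟩
      S.actT ĝ (S.actT ĥ t +V S.actT two (S.actT v′ t))
        ≈⟨ S.actT-cong ĝ (≐-sym (≐-trans (S.actT-+P ĥ (two *P v′) t) (+V-cong (≐-refl {u = S.actT ĥ t}) (S.actT-*P two v′ t)))) ⟩
      S.actT ĝ (S.actT (ĥ +P two *P v′) t)        ≈⟨ ≐-sym (S.actT-*P ĝ (ĥ +P two *P v′) t) ⟩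
      S.actT (ĝ *P (ĥ +P two *P v′)) t            ≈⟨ S.run~ (regroup (X^ kg) (X^ kh) (recip g) (recip h) two) t ⟩
      S.actT (G *P (X^ kg *P X^ kh)) t            ≈⟨ S.actT-*P G (X^ kg *P X^ kh) t ⟩
      S.actT G (S.actT (X^ kg *P X^ kh) t)        ∎
      where
      open S using (_⊕_; _⊗_; _⊜_)
      regroup : ∀ Xg Xh g h t → ((Xg *P g) *P ((Xh *P h) +P t *P Xh)) S.~ ((g *P h +P t *P g) *P (Xg *P Xh))
      regroup = S.solve 5 (λ Xg Xh g h t → ((Xg ⊗ g) ⊗ ((Xh ⊗ h) ⊕ t ⊗ Xh)) ⊜ ((g ⊗ h ⊕ t ⊗ g) ⊗ (Xg ⊗ Xh))) (S.mk~ λ v i → refl)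

    f[h+2]≈F : (f *P (h +P two)) U.~ F
    f[h+2]≈F = U.solve 3 (λ f h t → (f U.⊗ (h U.⊕ t)) U.⊜ (f U.⊗ h U.⊕ t U.⊗ f)) (U.mk~ λ v i → refl) f h two

    annihilated⇒image : ∀ y → U.actT F y ≐ P₄.zeroV → ∃[ c ] (y ≐ S.actT G c)
    annihilated⇒image y Fy≐0 = S.actT (X^ kg *P X^ kh) t , ≐-trans y≐G₀t (G₀-recip t)
      where
      y∈G₀ : ∃[ t ] (y C₄.≐ U.actT Ann.G₀ t)
      y∈G₀ = Ann.annihilated⇒image fgh≈0 (U.≈P⇒~ bezout-fg) (U.≈P⇒~ bezout-fh) (U.≈P⇒~ bezout-gh) vv′≈1 y
               (≐-trans (U.run~ f[h+2]≈F y) Fy≐0)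
      t : P₄.Vec n
      t = proj₁ y∈G₀
      y≐G₀t : y C₄.≐ U.actT Ann.G₀ t
      y≐G₀t = proj₂ y∈G₀

module Codes where

  -- Such a code is the product p·ℤ₂[x]/(xᵅ-1) × r·ℤ₄[x]/(xᵝ-1)
  -- (it is separable), and by adjointness of p(x) and p(x⁻¹) its dual is
  -- ann(p(x⁻¹)) × ann(r(x⁻¹)).

  open Rings
  open import Data.Nat using (ℕ)
  open import Data.List using ([]; _∷_; map)
  open import Data.Product using (∃-syntax; _×_; _,_; proj₁; proj₂)
  open import Relation.Binary.PropositionalEquality
  open ≡-Reasoning

  act₂-embed : ∀ {n} l p → P₂.act l (P₂.embed p) C₂.≐ C₂.S.actT p (C₂.S.actT l (P₂.e₀ {n}))
  act₂-embed l p = C₂.≐-trans (C₂.act≐actS l (P₂.embed p))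
    (C₂.≐-trans (C₂.S.actT-cong l (C₂.act≐actS p P₂.e₀)) (C₂.S.actT-comm l p P₂.e₀))

  act₄-embed : ∀ {n} l p → P₄.act l (P₄.embed p) C₄.≐ C₄.S.actT p (C₄.S.actT l (P₄.e₀ {n}))
  act₄-embed l p = C₄.≐-trans (C₄.act≐actS l (P₄.embed p))
    (C₄.≐-trans (C₄.S.actT-cong l (C₄.act≐actS p P₄.e₀)) (C₄.S.actT-comm l p P₄.e₀))

  act₂-zero : ∀ {n} l → P₂.act l (P₂.zeroV {n}) C₂.≐ P₂.zeroV
  act₂-zero l = C₂.≐-trans (C₂.act≐actS l P₂.zeroV) (C₂.S.actT-zero l)

  act₄-zero : ∀ {n} l → P₄.act l (P₄.zeroV {n}) C₄.≐ P₄.zeroV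
  act₄-zero l = C₄.≐-trans (C₄.act≐actS l P₄.zeroV) (C₄.S.actT-zero l)

  _∈₂⟨_⟩ : ∀ {α} → P₂.Vec α → Poly₂ → Set
  x ∈₂⟨ p ⟩ = ∃[ a ] (x C₂.≐ C₂.S.actT p a)

  _∈₄⟨_⟩ : ∀ {β} → P₄.Vec β → Poly₄ → Set
  y ∈₄⟨ r ⟩ = ∃[ c ] (y C₄.≐ C₄.S.actT r c)

  codeword-components : ∀ {α β} p r (u : Elem α β) → ⟨ bin p ∷ quat r ∷ [] ⟩ u → proj₁ u ∈₂⟨ p ⟩ × proj₂ u ∈₄⟨ r ⟩
  codeword-components p r (ux , uy) (l₁ , (wx , wy) , (l₂ , (w′x , w′y) , (w′x≡0 , w′y≡0) , (wx≡ , wy≡)) , (ux≡ , uy≡)) =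
    (C₂.S.actT (map red l₁) P₂.e₀ , ux≐) , (C₄.S.actT l₂ P₄.e₀ , uy≐)
    where
    ux≐ : ux C₂.≐ C₂.S.actT p (C₂.S.actT (map red l₁) P₂.e₀)
    ux≐ i = begin
      ux i                                                             ≡⟨ ux≡ i ⟩
      P₂.act (map red l₁) (P₂.embed p) i +₂ wx i                       ≡⟨ cong (P₂.act (map red l₁) (P₂.embed p) i +₂_) (wx≡ i) ⟩
      P₂.act (map red l₁) (P₂.embed p) i +₂ (P₂.act (map red l₂) P₂.zeroV i +₂ w′x i)
        ≡⟨ cong₂ (λ s t → P₂.act (map red l₁) (P₂.embed p) i +₂ (s +₂ t)) (act₂-zero (map red l₂) i) (w′x≡0 i) ⟩
      P₂.act (map red l₁) (P₂.embed p) i +₂ (0₂ +₂ 0₂)                ≡⟨ C₂.⊕-idʳ _ ⟩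
      P₂.act (map red l₁) (P₂.embed p) i                               ≡⟨ act₂-embed (map red l₁) p i ⟩
      C₂.S.actT p (C₂.S.actT (map red l₁) P₂.e₀) i                    ∎
    uy≐ : uy C₄.≐ C₄.S.actT r (C₄.S.actT l₂ P₄.e₀)
    uy≐ i = begin
      uy i                                                             ≡⟨ uy≡ i ⟩
      P₄.act l₁ P₄.zeroV i +₄ wy i                                     ≡⟨ cong₂ _+₄_ (act₄-zero l₁ i) (wy≡ i) ⟩
      0₄ +₄ (P₄.act l₂ (P₄.embed r) i +₄ w′y i)                        ≡⟨ C₄.⊕-idˡ _ ⟩
      P₄.act l₂ (P₄.embed r) i +₄ w′y i                                ≡⟨ cong (P₄.act l₂ (P₄.embed r) i +₄_) (w′y≡0 i) ⟩
      P₄.act l₂ (P₄.embed r) i +₄ 0₄                                   ≡⟨ C₄.⊕-idʳ _ ⟩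
      P₄.act l₂ (P₄.embed r) i                                         ≡⟨ act₄-embed l₂ r i ⟩
      C₄.S.actT r (C₄.S.actT l₂ P₄.e₀) i                              ∎

  lift : ℤ₂ → ℤ₄
  lift 0₂ = 0₄
  lift 1₂ = 1₄

  map-red-lift : ∀ (P : Poly₂) → map red (map lift P) ≡ P
  map-red-lift [] = refl
  map-red-lift (0₂ ∷ P) = cong (0₂ ∷_) (map-red-lift P)
  map-red-lift (1₂ ∷ P) = cong (1₂ ∷_) (map-red-lift P)

  -- conversely every (p a ∣ r c) is a codeword: take λ₁ = lift a and λ₂ = c
  codeword-intro : ∀ {α β} p r (v : Elem α β) → proj₁ v ∈₂⟨ p ⟩ → proj₂ v ∈₄⟨ r ⟩ → ⟨ bin p ∷ quat r ∷ [] ⟩ v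
  codeword-intro p r (vx , vy) (x , vx≐) (y , vy≐) =
    map lift X , ((Y ⋆ quat r) +E 0E) ,
    (Y , 0E , ((λ _ → refl) , (λ _ → refl)) , ((λ _ → refl) , (λ _ → refl))) , (vx≡ , vy≡)
    where
    X : Poly₂
    X = C₂.toPoly x
    Y : Poly₄
    Y = C₄.toPoly y
    vx≡ : ∀ i → vx i ≡ P₂.act (map red (map lift X)) (P₂.embed p) i +₂ (P₂.act (map red Y) P₂.zeroV i +₂ 0₂)
    vx≡ i = sym (begin
      P₂.act (map red (map lift X)) (P₂.embed p) i +₂ (P₂.act (map red Y) P₂.zeroV i +₂ 0₂)
        ≡⟨ cong (λ t → P₂.act (map red (map lift X)) (P₂.embed p) i +₂ (t +₂ 0₂)) (act₂-zero (map red Y) i) ⟩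
      P₂.act (map red (map lift X)) (P₂.embed p) i +₂ 0₂   ≡⟨ C₂.⊕-idʳ _ ⟩
      P₂.act (map red (map lift X)) (P₂.embed p) i         ≡⟨ cong (λ L → P₂.act L (P₂.embed p) i) (map-red-lift X) ⟩
      P₂.act X (P₂.embed p) i                              ≡⟨ act₂-embed X p i ⟩
      C₂.S.actT p (C₂.S.actT X P₂.e₀) i                    ≡⟨ C₂.S.actT-cong p (C₂.embed-toPoly x) i ⟩
      C₂.S.actT p x i                                      ≡⟨ vx≐ i ⟨
      vx i                                                 ∎)
    vy≡ : ∀ i → vy i ≡ P₄.act (map lift X) P₄.zeroV i +₄ (P₄.act Y (P₄.embed r) i +₄ 0₄)
    vy≡ i = sym (begin
      P₄.act (map lift X) P₄.zeroV i +₄ (P₄.act Y (P₄.embed r) i +₄ 0₄)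
        ≡⟨ cong (_+₄ (P₄.act Y (P₄.embed r) i +₄ 0₄)) (act₄-zero (map lift X) i) ⟩
      0₄ +₄ (P₄.act Y (P₄.embed r) i +₄ 0₄)                ≡⟨ C₄.⊕-idˡ _ ⟩
      P₄.act Y (P₄.embed r) i +₄ 0₄                        ≡⟨ C₄.⊕-idʳ _ ⟩
      P₄.act Y (P₄.embed r) i                              ≡⟨ act₄-embed Y r i ⟩
      C₄.S.actT r (C₄.S.actT Y P₄.e₀) i                    ≡⟨ C₄.S.actT-cong r (C₄.embed-toPoly y) i ⟩
      C₄.S.actT r y i                                      ≡⟨ vy≐ i ⟨
      vy i                                                 ∎)

  twice≡0 : ∀ s → twice s ≡ 0₄ → s ≡ 0₂
  twice≡0 0₂ e = refl

  module Dual {α β : ℕ} (p : Poly₂) (r : Poly₄) (vx : P₂.Vec α) (vy : P₄.Vec β) where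

    dual⇒annihilated : (⟨ bin p ∷ quat r ∷ [] ⟩ ⊥) (vx , vy) →
                       C₂.U.actT p vx C₂.≐ P₂.zeroV × C₄.U.actT r vy C₄.≐ P₄.zeroV
    dual⇒annihilated ⊥v = C₂.dot-nondegenerate _ binary , C₄.dot-nondegenerate _ quaternary
      where
      -- pair with the codewords (p x ∣ 0) …
      binary : ∀ x → C₂.dot x (C₂.U.actT p vx) ≡ 0₂
      binary x = trans (sym (C₂.adjoint p x vx)) (twice≡0 _ (begin
        twice (C₂.dot (C₂.S.actT p x) vx)                                      ≡⟨ C₄.⊕-idʳ _ ⟨
        twice (C₂.dot (C₂.S.actT p x) vx) +₄ 0₄                                ≡⟨ cong (twice (C₂.dot (C₂.S.actT p x) vx) +₄_) (C₄.dot-zeroˡ vy) ⟨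
        (C₂.S.actT p x , P₄.zeroV) · (vx , vy)                                 ≡⟨ ⊥v (C₂.S.actT p x , P₄.zeroV) (codeword-intro p r (C₂.S.actT p x , P₄.zeroV) (x , C₂.≐-refl) (P₄.zeroV , C₄.≐-sym (C₄.S.actT-zero r))) ⟩
        0₄                                                                     ∎))
      -- … and (0 ∣ r y)
      quaternary : ∀ y → C₄.dot y (C₄.U.actT r vy) ≡ 0₄
      quaternary y = trans (sym (C₄.adjoint r y vy)) (begin
        C₄.dot (C₄.S.actT r y) vy                                              ≡⟨ C₄.⊕-idˡ _ ⟨
        twice 0₂ +₄ C₄.dot (C₄.S.actT r y) vy                                  ≡⟨ cong (λ s → twice s +₄ C₄.dot (C₄.S.actT r y) vy) (C₂.dot-zeroˡ vx) ⟨
        (P₂.zeroV , C₄.S.actT r y) · (vx , vy)                                 ≡⟨ ⊥v (P₂.zeroV , C₄.S.actT r y) (codeword-intro p r (P₂.zeroV , C₄.S.actT r y) (P₂.zeroV , C₂.≐-sym (C₂.S.actT-zero p)) (y , C₄.≐-refl)) ⟩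
        0₄                                                                     ∎)

    annihilated⇒dual : C₂.U.actT p vx C₂.≐ P₂.zeroV → C₄.U.actT r vy C₄.≐ P₄.zeroV →
                       (⟨ bin p ∷ quat r ∷ [] ⟩ ⊥) (vx , vy)
    annihilated⇒dual pvx≐0 rvy≐0 u u∈C = cong₂ (λ s t → twice s +₄ t) binary quaternary
      where
      a : P₂.Vec α
      a = proj₁ (proj₁ (codeword-components p r u u∈C))
      ux≐ : proj₁ u C₂.≐ C₂.S.actT p a
      ux≐ = proj₂ (proj₁ (codeword-components p r u u∈C))
      c : P₄.Vec β
      c = proj₁ (proj₂ (codeword-components p r u u∈C))
      uy≐ : proj₂ u C₄.≐ C₄.S.actT r c
      uy≐ = proj₂ (proj₂ (codeword-components p r u u∈C))
      binary : C₂.dot (proj₁ u) vx ≡ 0₂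
      binary = begin
        C₂.dot (proj₁ u) vx              ≡⟨ C₂.dot-cong ux≐ (C₂.≐-refl {u = vx}) ⟩
        C₂.dot (C₂.S.actT p a) vx        ≡⟨ C₂.adjoint p a vx ⟩
        C₂.dot a (C₂.U.actT p vx)        ≡⟨ C₂.dot-cong (C₂.≐-refl {u = a}) pvx≐0 ⟩
        C₂.dot a P₂.zeroV                ≡⟨ C₂.dot-zeroʳ a ⟩
        0₂                               ∎
      quaternary : C₄.dot (proj₂ u) vy ≡ 0₄
      quaternary = begin
        C₄.dot (proj₂ u) vy              ≡⟨ C₄.dot-cong uy≐ (C₄.≐-refl {u = vy}) ⟩
        C₄.dot (C₄.S.actT r c) vy        ≡⟨ C₄.adjoint r c vy ⟩
        C₄.dot c (C₄.U.actT r vy)        ≡⟨ C₄.dot-cong (C₄.≐-refl {u = c}) rvy≐0 ⟩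
        C₄.dot c P₄.zeroV                ≡⟨ C₄.dot-zeroʳ c ⟩
        0₄                               ∎

open Codes
open Rings using (module C₂; module C₄)
open BinaryPart using (module ReciprocalAnnihilator)
open QuaternaryPart using (module Quaternary)

mainTheorem7 : (α β : ℕ) → Odd β →
  (b : Poly₂) (f g h : Poly₄) →
  P₄.Monic f → P₄.Monic g → P₄.Monic h →
  P₄.Coprime f g → P₄.Coprime f h → P₄.Coprime g h →
  f P₄.*P g P₄.*P h P₄.≈P Xn-1₄ β →
  b P₂.∣P Xn-1₂ α →
  -- q = (x^α - 1) / b*
  (q : Poly₂) → P₂.recip b P₂.*P q P₂.≈P Xn-1₂ α →
  (v : Elem α β) →
    ((⟨ bin b ∷ quat (f P₄.*P h P₄.+P (2₄ ∷ []) P₄.*P f) ∷ [] ⟩ ⊥) v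
      → ⟨ bin q ∷ quat (P₄.recip g P₄.*P P₄.recip h P₄.+P (2₄ ∷ []) P₄.*P P₄.recip g) ∷ [] ⟩ v)
    × (⟨ bin q ∷ quat (P₄.recip g P₄.*P P₄.recip h P₄.+P (2₄ ∷ []) P₄.*P P₄.recip g) ∷ [] ⟩ v
      → (⟨ bin b ∷ quat (f P₄.*P h P₄.+P (2₄ ∷ []) P₄.*P f) ∷ [] ⟩ ⊥) v)
mainTheorem7 α _ (k , refl) b f g h _ _ _ (a₁ , b₁ , fg) (a₂ , b₂ , fh) (a₃ , b₃ , gh) fgh _ q b*q (vx , vy) =
  dual⇒D , D⇒dual
  where
  module Bin = ReciprocalAnnihilator α b q b*q
  module Quat = Quaternary f g h a₁ b₁ a₂ b₂ a₃ b₃ fgh fg fh gh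
  open Dual b Quat.F vx vy

  -- v ⊥ C  ⇒  b(x⁻¹) vx = 0 and F(x⁻¹) vy = 0  ⇒  vx ∈ ⟨q⟩ and vy ∈ ⟨G⟩
  dual⇒D : (⟨ bin b ∷ quat Quat.F ∷ [] ⟩ ⊥) (vx , vy) → ⟨ bin q ∷ quat Quat.G ∷ [] ⟩ (vx , vy)
  dual⇒D v⊥C = codeword-intro q Quat.G (vx , vy)
    (Bin.annihilated⇒ideal vx (proj₁ (dual⇒annihilated v⊥C)))
    (Quat.annihilated⇒image vy (proj₂ (dual⇒annihilated v⊥C)))

  -- vx = q a and vy = G c  ⇒  b(x⁻¹) vx = 0 and F(x⁻¹) vy = 0  ⇒  v ⊥ C
  D⇒dual : ⟨ bin q ∷ quat Quat.G ∷ [] ⟩ (vx , vy) → (⟨ bin b ∷ quat Quat.F ∷ [] ⟩ ⊥) (vx , vy)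
  D⇒dual v∈D = annihilated⇒dual
    (C₂.≐-trans (C₂.U.actT-cong b (proj₂ x∈⟨q⟩)) (Bin.ideal⇒annihilated (proj₁ x∈⟨q⟩)))
    (C₄.≐-trans (C₄.U.actT-cong Quat.F (proj₂ y∈⟨G⟩)) (Quat.image⇒annihilated (proj₁ y∈⟨G⟩)))
    where
    x∈⟨q⟩ : vx ∈₂⟨ q ⟩
    x∈⟨q⟩ = proj₁ (codeword-components q Quat.G (vx , vy) v∈D)
    y∈⟨G⟩ : vy ∈₄⟨ Quat.G ⟩
    y∈⟨G⟩ = proj₂ (codeword-components q Quat.G (vx , vy) v∈D)
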